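{- For every integer $n\ge1$, $$\mathrm{pk}_n(312)=\sum_{C\in\mathcal{C}_n}\prod_{i=2}^{|w(C)|}\Big(1+\sum_{j=i}^{|w(C)|}w(C)_j\Big).$$ Consequently $\mathrm{pk}_n(312)=\sum_{k=1}^np_{n,k}$, where $p_{n,n}=1$ and, for $1\le k\le n-1$, $$p_{n,k}=(n-k+1)\sum_{i=n-k}^{n-1}\sum_{j=k+1-n+i}^{i}p_{i,j}.$$ Furthermore, as formal power series in $x$, $$\frac{x}{1-x}=\sum_{n=1}^\infty \mathrm{pk}_n(312)\,\frac{x^n(1-x)^n}{\prod_{\ell=1}^n(1+\ell x)}.$$
   Context: For a positive integer $n$, $[n]=\{1,\dots,n\}$. A function $f:[n]\to[n]$ is a parking function if for every $i\in[n]$, $|\{j\in[n]: f(j)\le i\}|\ge i$ (equivalently, in the usual car-parking process where car $i$ prefers spot $f(i)$ and takes the first free spot at or after it, all cars park). The parking permutation $\rho_f\in S_n$ is defined by: spot $i$ is occupied by car $\rho_f(i)$. A permutation $\pi\in S_n$ contains $\sigma\in S_m$ as a pattern if there exist $1\le i_1<\dots<i_m\le n$ with $\pi(i_a)<\pi(i_b)$ iff $\sigma(a)<\sigma(b)$ for all $a,b$; otherwise it avoids $\sigma$. $\mathrm{pk}_n(\sigma)$ is the number of parking functions $f:[n]\to[n]$ with $\rho_f$ avoiding $\sigma$. $\mathcal{C}_n$ is the set of Catalan paths of length $2n$: sequences of $n$ up-steps and $n$ down-steps whose every prefix has at least as many up-steps as down-steps. For $C\in\mathcal{C}_n$, $w(C)$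 is the sequence recording in order the lengths of the maximal blocks of consecutive up-steps in $C$ (e.g. $w(UDUUDUDD)=(1,2,1)$), $|w(C)|$ its length and $w(C)_i$ its $i$-th entry. -}

module Defs where

open import Data.Nat using (ℕ; zero; suc; _+_; _*_; _∸_; _≤_; _<_; _≤?_)
open import Data.Nat.Properties using ()
open import Data.Integer as ℤ using (ℤ; -_)
open import Data.Nat.ListAction using (sum; product)
open import Data.List using (List; []; _∷_; map; concatMap; length; filter; upTo; replicate; take; lookup)
open import Data.List.Relation.Binary.Sublist.Propositional using (_⊆_)
open import Data.Maybe using (Maybe; just; nothing; fromMaybe)
open import Data.Fin using (Fin; cast)
open import Data.Product using (Σ; _×_; Σ-syntax)
open import Relation.Nullary using (¬_)
open import Relation.Binary.PropositionalEquality using (_≡_)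
open import Function.Bundles using (_⇔_)

-- Finite sums / counts over an explicit enumeration, given relationally
-- (so no decidability proof is needed to *state* them).
-- SumOver P g xs N  :  N = Σ_{x ∈ xs, P x} g x .

data SumOver {A : Set} (P : A → Set) (g : A → ℕ) : List A → ℕ → Set where
  none : SumOver P g [] 0
  keep : ∀ {x xs N} → P x → SumOver P g xs N → SumOver P g (x ∷ xs) (g x + N)
  skip : ∀ {x xs N} → ¬ P x → SumOver P g xs N → SumOver P g (x ∷ xs) N

CountOver : {A : Set} → (A → Set) → List A → ℕ → Set
CountOver P xs N = SumOver P (λ _ → 1) xs N

-- the list [a, a+1, ..., b]  (empty if b < a)
fromTo : ℕ → ℕ → List ℕ
fromTo a b = map (a +_) (upTo (suc b ∸ a))

-- 1-indexed access to a list of naturals (0 outside the range)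
at : List ℕ → ℕ → ℕ
at []       _             = 0
at (x ∷ xs) zero          = 0
at (x ∷ xs) (suc zero)    = x
at (x ∷ xs) (suc (suc i)) = at xs (suc i)

-- Functions [n] → [n], represented as the list (f(1),…,f(n)).

words : ℕ → ℕ → List (List ℕ)
words zero    n = [] ∷ []
words (suc k) n = concatMap (λ v → map (_∷ v) (fromTo 1 n)) (words k n)

allFuns : ℕ → List (List ℕ)
allFuns n = words n n

IsParkingFunction : ℕ → List ℕ → Set
IsParkingFunction n f = ∀ i → 1 ≤ i → i ≤ n → i ≤ length (filter (_≤? i) f)

-- Parking process.  place c p occ : car c, preferring spot p (1-indexed),
-- takes the first free spot at or after p.  occ : spot ↦ car (or empty).
place : ℕ → ℕ → List (Maybe ℕ) → List (Maybe ℕ)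
place c p             []             = []
place c (suc (suc p)) (o ∷ os)       = o ∷ place c (suc p) os
place c zero          (nothing ∷ os) = just c ∷ os
place c (suc zero)    (nothing ∷ os) = just c ∷ os
place c zero          (just d ∷ os)  = just d ∷ place c zero os
place c (suc zero)    (just d ∷ os)  = just d ∷ place c (suc zero) os

parkFrom : ℕ → List ℕ → List (Maybe ℕ) → List (Maybe ℕ)
parkFrom c []       occ = occ
parkFrom c (p ∷ ps) occ = parkFrom (suc c) ps (place c p occ)

-- parking permutation ρ_f as the list (ρ_f(1),…,ρ_f(n)):
-- spot i is occupied by car ρ_f(i).  (Empty spots, which only occur
-- when f is not a parking function, are recorded as 0.)
parkingPerm : List ℕ → List ℕ
parkingPerm f = map (fromMaybe 0) (parkFrom 1 f (replicate (length f) nothing))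

-- Pattern containment.  Since a permutation has distinct entries,
-- choosing positions i₁<…<iₘ is the same as choosing a subsequence s ⊆ π.

OrderIsomorphic : List ℕ → List ℕ → Set
OrderIsomorphic s σ =
  Σ[ e ∈ length s ≡ length σ ]
    (∀ (a b : Fin (length s)) →
       (lookup s a < lookup s b) ⇔ (lookup σ (cast e a) < lookup σ (cast e b)))

Contains : List ℕ → List ℕ → Set
Contains π σ = Σ[ s ∈ List ℕ ] (s ⊆ π × OrderIsomorphic s σ)

Avoids : List ℕ → List ℕ → Set
Avoids π σ = ¬ Contains π σ

pattern312 : List ℕ
pattern312 = 3 ∷ 1 ∷ 2 ∷ []

PF312 : ℕ → List ℕ → Set
PF312 n f = IsParkingFunction n f × Avoids (parkingPerm f) pattern312

data Step : Set where
  U D : Step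

countU : List Step → ℕ
countU []      = 0
countU (U ∷ s) = suc (countU s)
countU (D ∷ s) = countU s

countD : List Step → ℕ
countD []      = 0
countD (U ∷ s) = countD s
countD (D ∷ s) = suc (countD s)

allSteps : ℕ → List (List Step)
allSteps zero    = [] ∷ []
allSteps (suc k) = concatMap (λ s → (U ∷ s) ∷ (D ∷ s) ∷ []) (allSteps k)

IsCatalan : ℕ → List Step → Set
IsCatalan n C = countU C ≡ n × countD C ≡ n
              × (∀ k → countD (take k C) ≤ countU (take k C))

-- w(C): lengths of maximal blocks of consecutive up-steps, in order
upRunsAcc : ℕ → List Step → List ℕ
upRunsAcc zero    []      = []
upRunsAcc (suc k) []      = suc k ∷ []
upRunsAcc k       (U ∷ s) = upRunsAcc (suc k) s
upRunsAcc zero    (D ∷ s) = upRunsAcc zero s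
upRunsAcc (suc k) (D ∷ s) = suc k ∷ upRunsAcc zero s

w : List Step → List ℕ
w = upRunsAcc 0

catWeight : List Step → ℕ
catWeight C =
  let v = w C ; L = length v in
  product (map (λ i → 1 + sum (map (at v) (fromTo i L))) (fromTo 2 L))

PRec : (ℕ → ℕ → ℕ) → Set
PRec p =
  (∀ n → 1 ≤ n → p n n ≡ 1) ×
  (∀ n k → 1 ≤ k → k ≤ n ∸ 1 →
     p n k ≡ (n ∸ k + 1) *
       sum (map (λ i → sum (map (λ j → p i j) (fromTo (k + 1 + i ∸ n) i)))
                (fromTo (n ∸ k) (n ∸ 1))))

Series : Set
Series = ℕ → ℤ

_⊛_ : Series → Series → Series
(f ⊛ g) N = Data.List.foldr ℤ._+_ (ℤ.+ 0) (map (λ a → f a ℤ.* g (N ∸ a)) (upTo (suc N)))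

one : Series
one zero    = ℤ.+ 1
one (suc _) = ℤ.+ 0

xPow : ℕ → Series
xPow n m with n Data.Nat.≟ m
... | Relation.Nullary.yes _ = ℤ.+ 1
... | Relation.Nullary.no  _ = ℤ.+ 0

oneMinusX : Series
oneMinusX zero          = ℤ.+ 1
oneMinusX (suc zero)    = - (ℤ.+ 1)
oneMinusX (suc (suc _)) = ℤ.+ 0

-- 1/(1 + ℓx) = ∑_m (-ℓ)^m x^m
invOnePlus : ℕ → Series
invOnePlus ℓ m = (- (ℤ.+ ℓ)) ℤ.^ m

powS : Series → ℕ → Series
powS f zero    = one
powS f (suc n) = f ⊛ powS f n

gfTerm : ℕ → Series
gfTerm n = xPow n ⊛ (powS oneMinusX n ⊛ Data.List.foldr _⊛_ one (map invOnePlus (fromTo 1 n)))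

-- coefficient of x^N in ∑_{n≥1} a_n · gfTerm n.  Since gfTerm n is divisible
-- by x^n, only the terms n ≤ N contribute (this is the formal-power-series sum).
gfCoeff : (ℕ → ℕ) → ℕ → ℤ
gfCoeff a N = Data.List.foldr ℤ._+_ (ℤ.+ 0)
                (map (λ n → ℤ.+ (a n) ℤ.* gfTerm n N) (fromTo 1 N))

xOverOneMinusX : Series
xOverOneMinusX zero    = ℤ.+ 0
xOverOneMinusX (suc _) = ℤ.+ 1

-- Everything is expressed through F_n(m), the sum over Catalan paths with n up-steps of the
-- product, over the maximal up-runs, of 1 + m + (number of up-steps after the run); pk_n = F_n(0).
-- Cutting a path at its last return to the axis gives F_{n+1}(m) = Σ_t F_{n-t}(m+t+1) P_{t+1}(m),
-- where the final prime path with k up-steps weighs P_1(m) = m + 1 and P_{j+1}(m) = F_j(m).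
--
-- The parking permutation avoids 312 exactly when every car parks in the leftmost block of free
-- spots: a car passing a free spot in front of an earlier car t creates the pattern e t c with
-- the later car e filling that spot. Filling a block of l free spots preceded by m occupied ones
-- under this rule can be done in F_l(m) ways, by the same recursion: the first car takes the
-- first free spot (m + 1 preferences) or splits the block in two.
--
-- Grouping paths by the length k of their first run gives p_{n,k}, and the recursion for F
-- shows coefficientwise that Σ_n F_n(m) x^n (1-x)^n / ∏_{ℓ=m+1}^{m+n} (1+ℓx) = (1 + m x)/(1 - x).
module Submission where

open import Defs
open import Data.Nat using (ℕ; _≤_)
open import Data.List using (map)
open import Data.Nat.ListAction using (sum)
open import Data.Product using (Σ; _×_; Σ-syntax; _,_)
open import Relation.Binary.PropositionalEquality using (_≡_)

module Sums where

  open import Algebra.Bundles using (CommutativeSemiring)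
  open import Data.Nat as ℕ using (ℕ; zero; suc; _∸_; _<_; _≤_; s≤s⁻¹)
  import Data.Nat.Properties as ℕ
  import Data.Integer.Properties as ℤ
  open import Data.List using (List; []; _∷_; _++_; map; foldr; concatMap; length; upTo; applyUpTo)
  open import Data.List.Properties using (map-applyUpTo; map-upTo; upTo-∷ʳ)
  open import Data.List.Membership.Propositional using (_∈_)
  open import Data.List.Membership.Propositional.Properties using (∈-upTo⁻; ∈-map⁻)
  open import Data.Product using (_×_; _,_)
  open import Relation.Nullary using (¬_)
  open import Defs using (fromTo; SumOver; none; keep; skip)
  open import Data.List.Relation.Unary.Any using (here; there)
  open import Function using (_∘_; id)
  open import Data.Sum using (_⊎_; inj₁; inj₂)
  open import Relation.Binary.PropositionalEquality as ≡ using (_≡_)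

  applyUpTo-+ : {A : Set} (f : ℕ → A) (k j : ℕ) → applyUpTo f (k ℕ.+ j) ≡ applyUpTo f k ++ applyUpTo (f ∘ (k ℕ.+_)) j
  applyUpTo-+ f zero    j = ≡.refl
  applyUpTo-+ f (suc k) j = ≡.cong (f 0 ∷_) (applyUpTo-+ (f ∘ suc) k j)

  module FiniteSum {c ℓ} (R : CommutativeSemiring c ℓ) where

    open CommutativeSemiring R
    open import Relation.Binary.Reasoning.Setoid setoid
    open import Algebra.Properties.CommutativeSemigroup +-commutativeSemigroup using (interchange)

    ∑ : {A : Set} → (A → Carrier) → List A → Carrier
    ∑ f xs = foldr _+_ 0# (map f xs)

    module _ {A : Set} where

      ∑-++ : (f : A → Carrier) (xs ys : List A) → ∑ f (xs ++ ys) ≈ ∑ f xs + ∑ f ys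
      ∑-++ f []       ys = sym (+-identityˡ _)
      ∑-++ f (x ∷ xs) ys = trans (+-congˡ (∑-++ f xs ys)) (sym (+-assoc _ _ _))

      ∑-cong : {f g : A → Carrier} (xs : List A) → (∀ x → f x ≈ g x) → ∑ f xs ≈ ∑ g xs
      ∑-cong []       f≈g = refl
      ∑-cong (x ∷ xs) f≈g = +-cong (f≈g x) (∑-cong xs f≈g)

      ∑-cong-∈ : {f g : A → Carrier} (xs : List A) → (∀ {x} → x ∈ xs → f x ≈ g x) → ∑ f xs ≈ ∑ g xs
      ∑-cong-∈ []       f≈g = refl
      ∑-cong-∈ (x ∷ xs) f≈g = +-cong (f≈g (here ≡.refl)) (∑-cong-∈ xs (f≈g ∘ there))

      ∑-zero : (xs : List A) → ∑ (λ _ → 0#) xs ≈ 0#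
      ∑-zero []       = refl
      ∑-zero (x ∷ xs) = trans (+-identityˡ _) (∑-zero xs)

      ∑-+ : (f g : A → Carrier) (xs : List A) → ∑ (λ x → f x + g x) xs ≈ ∑ f xs + ∑ g xs
      ∑-+ f g []       = sym (+-identityˡ 0#)
      ∑-+ f g (x ∷ xs) = trans (+-congˡ (∑-+ f g xs)) (interchange _ _ _ _)

      ∑-*ˡ : (a : Carrier) (f : A → Carrier) (xs : List A) → ∑ (λ x → a * f x) xs ≈ a * ∑ f xs
      ∑-*ˡ a f []       = sym (zeroʳ a)
      ∑-*ˡ a f (x ∷ xs) = trans (+-congˡ (∑-*ˡ a f xs)) (sym (distribˡ a _ _))

      ∑-*ʳ : (a : Carrier) (f : A → Carrier) (xs : List A) → ∑ (λ x → f x * a) xs ≈ ∑ f xs * a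
      ∑-*ʳ a f []       = sym (zeroˡ a)
      ∑-*ʳ a f (x ∷ xs) = trans (+-congˡ (∑-*ʳ a f xs)) (sym (distribʳ a _ _))

    ∑-map : {A B : Set} (f : B → Carrier) (g : A → B) (xs : List A) → ∑ f (map g xs) ≡ ∑ (f ∘ g) xs
    ∑-map f g []       = ≡.refl
    ∑-map f g (x ∷ xs) = ≡.cong (f (g x) +_) (∑-map f g xs)

    ∑-concatMap : {A B : Set} (f : B → Carrier) (g : A → List B) (xs : List A) →
                  ∑ f (concatMap g xs) ≈ ∑ (λ x → ∑ f (g x)) xs
    ∑-concatMap f g []       = refl
    ∑-concatMap f g (x ∷ xs) = trans (∑-++ f (g x) (concatMap g xs)) (+-congˡ (∑-concatMap f g xs))

    ∑-comm : {A B : Set} (f : A → B → Carrier) (xs : List A) (ys : List B) →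
             ∑ (λ x → ∑ (f x) ys) xs ≈ ∑ (λ y → ∑ (λ x → f x y) xs) ys
    ∑-comm f []       ys = sym (∑-zero ys)
    ∑-comm f (x ∷ xs) ys = trans (+-congˡ (∑-comm f xs ys)) (sym (∑-+ (f x) _ ys))

    ∑-upTo-suc : (g : ℕ → Carrier) (n : ℕ) → ∑ g (upTo (suc n)) ≡ g 0 + ∑ (g ∘ suc) (upTo n)
    ∑-upTo-suc g n = ≡.cong (λ xs → g 0 + foldr _+_ 0# xs)
      (≡.trans (map-applyUpTo suc g n) (≡.sym (map-applyUpTo id (g ∘ suc) n)))

    ∑-upTo-∷ʳ : (g : ℕ → Carrier) (n : ℕ) → ∑ g (upTo (suc n)) ≈ ∑ g (upTo n) + g n
    ∑-upTo-∷ʳ g n = begin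
      ∑ g (upTo (suc n))              ≡⟨ ≡.cong (∑ g) (≡.sym (upTo-∷ʳ n)) ⟩
      ∑ g (upTo n ++ n ∷ [])          ≈⟨ ∑-++ g (upTo n) (n ∷ []) ⟩
      ∑ g (upTo n) + (g n + 0#)       ≈⟨ +-congˡ (+-identityʳ (g n)) ⟩
      ∑ g (upTo n) + g n              ∎

    ∑-upTo-+ : (g : ℕ → Carrier) (k j : ℕ) →
               ∑ g (upTo (k ℕ.+ j)) ≈ ∑ g (upTo k) + ∑ (λ t → g (k ℕ.+ t)) (upTo j)
    ∑-upTo-+ g k j = begin
      ∑ g (upTo (k ℕ.+ j))                                ≡⟨ ≡.cong (∑ g) (applyUpTo-+ id k j) ⟩
      ∑ g (upTo k ++ applyUpTo (k ℕ.+_) j)                ≈⟨ ∑-++ g (upTo k) (applyUpTo (k ℕ.+_) j) ⟩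
      ∑ g (upTo k) + ∑ g (applyUpTo (k ℕ.+_) j)           ≡⟨ ≡.cong (λ xs → ∑ g (upTo k) + foldr _+_ 0# xs) shift ⟩
      ∑ g (upTo k) + ∑ (λ t → g (k ℕ.+ t)) (upTo j)       ∎
      where
      shift : map g (applyUpTo (k ℕ.+_) j) ≡ map (λ t → g (k ℕ.+ t)) (upTo j)
      shift = ≡.trans (map-applyUpTo (k ℕ.+_) g j) (≡.sym (map-upTo (λ t → g (k ℕ.+ t)) j))

    ∑-upTo-reverse : (h : ℕ → Carrier) (n : ℕ) → ∑ h (upTo (suc n)) ≈ ∑ (λ a → h (n ∸ a)) (upTo (suc n))
    ∑-upTo-reverse h zero    = refl
    ∑-upTo-reverse h (suc n) = begin
      ∑ h (upTo (suc (suc n)))                                     ≡⟨ ∑-upTo-suc h (suc n) ⟩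
      h 0 + ∑ (h ∘ suc) (upTo (suc n))                             ≈⟨ +-congˡ (∑-upTo-reverse (h ∘ suc) n) ⟩
      h 0 + ∑ (λ a → h (suc (n ∸ a))) (upTo (suc n))               ≈⟨ +-comm _ _ ⟩
      ∑ (λ a → h (suc (n ∸ a))) (upTo (suc n)) + h 0               ≈⟨ +-cong (∑-cong-∈ (upTo (suc n)) reindex) (reflexive (≡.cong h (≡.sym (ℕ.n∸n≡0 n)))) ⟩
      ∑ (λ a → h (suc n ∸ a)) (upTo (suc n)) + h (suc n ∸ suc n)   ≈⟨ sym (∑-upTo-∷ʳ (λ a → h (suc n ∸ a)) (suc n)) ⟩
      ∑ (λ a → h (suc n ∸ a)) (upTo (suc (suc n)))                 ∎
      where
      reindex : ∀ {a} → a ∈ upTo (suc n) → h (suc (n ∸ a)) ≈ h (suc n ∸ a)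
      reindex a∈ = reflexive (≡.cong h (≡.sym (ℕ.+-∸-assoc 1 (s≤s⁻¹ (∈-upTo⁻ a∈)))))

    ∑-upTo-truncate : (g : ℕ → Carrier) {m n : ℕ} → m ≤ n → (∀ {j} → m < j → g j ≈ 0#) →
                      ∑ g (upTo (suc n)) ≈ ∑ g (upTo (suc m))
    ∑-upTo-truncate g {m} {n} m≤n vanish with ℕ.m≤n⇒m<n∨m≡n m≤n
    ... | inj₂ ≡.refl = refl
    ... | inj₁ m<n with n
    ...   | suc n′ = begin
      ∑ g (upTo (suc (suc n′)))       ≈⟨ ∑-upTo-∷ʳ g (suc n′) ⟩
      ∑ g (upTo (suc n′)) + g (suc n′) ≈⟨ +-cong (∑-upTo-truncate g (s≤s⁻¹ m<n) vanish) (vanish m<n) ⟩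
      ∑ g (upTo (suc m)) + 0#         ≈⟨ +-identityʳ _ ⟩
      ∑ g (upTo (suc m))              ∎

    ∑-triangle : (h : ℕ → ℕ → Carrier) (S : ℕ) →
                 ∑ (λ n → ∑ (λ t → h t (n ∸ t)) (upTo (suc n))) (upTo S) ≈ ∑ (λ t → ∑ (h t) (upTo (S ∸ t))) (upTo S)
    ∑-triangle h zero    = refl
    ∑-triangle h (suc S) = begin
      ∑ (λ n → diagonal n) (upTo (suc S))                                      ≈⟨ ∑-upTo-∷ʳ diagonal S ⟩
      ∑ (λ n → diagonal n) (upTo S) + diagonal S                               ≈⟨ +-congʳ (∑-triangle h S) ⟩
      ∑ (λ t → ∑ (h t) (upTo (S ∸ t))) (upTo S) + diagonal S                   ≈⟨ +-congʳ (sym last-column-empty) ⟩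
      ∑ (λ t → ∑ (h t) (upTo (S ∸ t))) (upTo (suc S)) + diagonal S             ≈⟨ sym (∑-+ _ _ (upTo (suc S))) ⟩
      ∑ (λ t → ∑ (h t) (upTo (S ∸ t)) + h t (S ∸ t)) (upTo (suc S))            ≈⟨ ∑-cong-∈ (upTo (suc S)) (λ t∈ → sym (column (s≤s⁻¹ (∈-upTo⁻ t∈)))) ⟩
      ∑ (λ t → ∑ (h t) (upTo (suc S ∸ t))) (upTo (suc S))                      ∎
      where
      diagonal : ℕ → Carrier
      diagonal n = ∑ (λ t → h t (n ∸ t)) (upTo (suc n))
      last-column-empty : ∑ (λ t → ∑ (h t) (upTo (S ∸ t))) (upTo (suc S)) ≈ ∑ (λ t → ∑ (h t) (upTo (S ∸ t))) (upTo S)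
      last-column-empty = trans (∑-upTo-∷ʳ _ S)
        (trans (+-congˡ (reflexive (≡.cong (λ k → ∑ (h S) (upTo k)) (ℕ.n∸n≡0 S)))) (+-identityʳ _))
      column : ∀ {t} → t ≤ S → ∑ (h t) (upTo (suc S ∸ t)) ≈ ∑ (h t) (upTo (S ∸ t)) + h t (S ∸ t)
      column {t} t≤S = trans (reflexive (≡.cong (λ k → ∑ (h t) (upTo k)) (ℕ.+-∸-assoc 1 t≤S))) (∑-upTo-∷ʳ (h t) (S ∸ t))

  module ℕΣ = FiniteSum ℕ.+-*-commutativeSemiring
  module ℤΣ = FiniteSum ℤ.+-*-commutativeSemiring

  ∑-const : {A : Set} (c : ℕ) (xs : List A) → ℕΣ.∑ (λ _ → c) xs ≡ length xs ℕ.* c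
  ∑-const c []       = ≡.refl
  ∑-const c (x ∷ xs) = ≡.cong (c ℕ.+_) (∑-const c xs)

  ∈-fromTo⁻ : ∀ {x} a b → x ∈ fromTo a b → a ≤ x × x ≤ b
  ∈-fromTo⁻ a b x∈ with ∈-map⁻ (a ℕ.+_) x∈
  ... | i , i∈ , ≡.refl = ℕ.m≤m+n a i , ℕ.≤-pred (begin-strict
    a ℕ.+ i              <⟨ ℕ.+-monoʳ-< a (∈-upTo⁻ i∈) ⟩
    a ℕ.+ (suc b ∸ a)    ≡⟨ ℕ.m+[n∸m]≡n a≤b+1 ⟩
    suc b                ∎)
    where
    open ℕ.≤-Reasoning
    a≤b+1 : a ≤ suc b
    a≤b+1 = ℕ.<⇒≤ (ℕ.m∸n≢0⇒n<m (λ b+1∸a≡0 → ℕ.n≮0 (≡.subst (i <_) b+1∸a≡0 (∈-upTo⁻ i∈))))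

  Restricts : {A : Set} → (A → Set) → (g h : A → ℕ) → A → Set
  Restricts P g h x = (P x × h x ≡ g x) ⊎ (¬ P x × h x ≡ 0)

  SumOver-∑ : {A : Set} {P : A → Set} {g : A → ℕ} (h : A → ℕ) (xs : List A) →
              (∀ {x} → x ∈ xs → Restricts P g h x) → SumOver P g xs (ℕΣ.∑ h xs)
  SumOver-∑ h []       restricts = none
  SumOver-∑ h (x ∷ xs) restricts with restricts (here ≡.refl)
  ... | inj₁ (px , hx≡gx) rewrite hx≡gx = keep px (SumOver-∑ h xs (restricts ∘ there))
  ... | inj₂ (¬px , hx≡0) rewrite hx≡0 = skip ¬px (SumOver-∑ h xs (restricts ∘ there))

module PowerSeries where

  open import Algebra.Bundles using (CommutativeMonoid)
  open import Algebra.Structures using (IsCommutativeMonoid)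
  open import Data.Nat as ℕ using (ℕ; zero; suc; _∸_; s≤s⁻¹)
  import Data.Nat.Properties as ℕ
  open import Data.Integer using (+_; _+_; _*_)
  open import Data.Integer.Properties
  open import Data.List using (upTo)
  open import Data.List.Membership.Propositional.Properties using (∈-upTo⁻)
  open import Function using (_∘_)
  open import Level using (0ℓ)
  open import Relation.Binary.PropositionalEquality
  open import Data.Integer.Tactic.RingSolver using (solve-∀)
  open import Defs using (_⊛_; one)
  open Sums
  open ℤΣ

  ⊛-zero : ∀ f g → (f ⊛ g) 0 ≡ f 0 * g 0
  ⊛-zero f g = +-identityʳ (f 0 * g 0)

  ⊛-suc : ∀ f g N → (f ⊛ g) (suc N) ≡ f 0 * g (suc N) + ((f ∘ suc) ⊛ g) N
  ⊛-suc f g N = ∑-upTo-suc (λ a → f a * g (suc N ∸ a)) (suc N)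

  ⊛-cong : ∀ {f f′ g g′} → f ≗ f′ → g ≗ g′ → (f ⊛ g) ≗ (f′ ⊛ g′)
  ⊛-cong f≗f′ g≗g′ N = ∑-cong (upTo (suc N)) (λ a → cong₂ _*_ (f≗f′ a) (g≗g′ (N ∸ a)))

  ⊛-congˡ : ∀ f {g g′} → g ≗ g′ → (f ⊛ g) ≗ (f ⊛ g′)
  ⊛-congˡ f = ⊛-cong {f} (λ _ → refl)

  ⊛-congʳ : ∀ {f f′} g → f ≗ f′ → (f ⊛ g) ≗ (f′ ⊛ g)
  ⊛-congʳ g f≗f′ = ⊛-cong {g = g} f≗f′ (λ _ → refl)

  ⊛-distribʳ : ∀ f f′ g → ((λ i → f i + f′ i) ⊛ g) ≗ (λ N → (f ⊛ g) N + (f′ ⊛ g) N)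
  ⊛-distribʳ f f′ g N = trans (∑-cong (upTo (suc N)) (λ a → *-distribʳ-+ (g (N ∸ a)) (f a) (f′ a)))
                              (∑-+ (λ a → f a * g (N ∸ a)) (λ a → f′ a * g (N ∸ a)) (upTo (suc N)))

  ⊛-*ˡ : ∀ c f g → ((λ i → c * f i) ⊛ g) ≗ (λ N → c * (f ⊛ g) N)
  ⊛-*ˡ c f g N = trans (∑-cong (upTo (suc N)) (λ a → *-assoc c (f a) (g (N ∸ a))))
                       (∑-*ˡ c (λ a → f a * g (N ∸ a)) (upTo (suc N)))

  ⊛-zeroˡ : ∀ g → ((λ _ → + 0) ⊛ g) ≗ (λ _ → + 0)
  ⊛-zeroˡ g N = trans (∑-cong (upTo (suc N)) (λ a → *-zeroˡ (g (N ∸ a)))) (∑-zero (upTo (suc N)))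

  ⊛-identityˡ : ∀ f → (one ⊛ f) ≗ f
  ⊛-identityˡ f zero    = trans (⊛-zero one f) (*-identityˡ (f 0))
  ⊛-identityˡ f (suc N) = trans (⊛-suc one f N) (trans (cong₂ _+_ (*-identityˡ (f (suc N))) (⊛-zeroˡ f N)) (+-identityʳ _))

  ⊛-comm : ∀ f g → (f ⊛ g) ≗ (g ⊛ f)
  ⊛-comm f g N = trans (∑-upTo-reverse (λ a → f a * g (N ∸ a)) N)
    (∑-cong-∈ (upTo (suc N)) λ {a} a∈ → trans (cong (f (N ∸ a) *_) (cong g (ℕ.m∸[m∸n]≡n (s≤s⁻¹ (∈-upTo⁻ a∈))))) (*-comm (f (N ∸ a)) (g a)))

  ⊛-assoc : ∀ f g h → ((f ⊛ g) ⊛ h) ≗ (f ⊛ (g ⊛ h))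
  ⊛-assoc f g h zero    = begin
    ((f ⊛ g) ⊛ h) 0       ≡⟨ trans (⊛-zero (f ⊛ g) h) (cong (_* h 0) (⊛-zero f g)) ⟩
    f 0 * g 0 * h 0       ≡⟨ *-assoc (f 0) (g 0) (h 0) ⟩
    f 0 * (g 0 * h 0)     ≡⟨ sym (trans (⊛-zero f (g ⊛ h)) (cong (f 0 *_) (⊛-zero g h))) ⟩
    (f ⊛ (g ⊛ h)) 0       ∎
    where open ≡-Reasoning
  ⊛-assoc f g h (suc N) = begin
    ((f ⊛ g) ⊛ h) (suc N)
      ≡⟨ trans (⊛-suc (f ⊛ g) h N) (cong (λ u → u * h (suc N) + (((f ⊛ g) ∘ suc) ⊛ h) N) (⊛-zero f g)) ⟩
    f 0 * g 0 * h (suc N) + (((f ⊛ g) ∘ suc) ⊛ h) N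
      ≡⟨ cong (λ u → f 0 * g 0 * h (suc N) + u) (trans (⊛-cong {g = h} (⊛-suc f g) (λ _ → refl) N)
                                           (⊛-distribʳ (λ M → f 0 * g (suc M)) ((f ∘ suc) ⊛ g) h N)) ⟩
    f 0 * g 0 * h (suc N) + (((λ M → f 0 * g (suc M)) ⊛ h) N + (((f ∘ suc) ⊛ g) ⊛ h) N)
      ≡⟨ cong₂ (λ u v → f 0 * g 0 * h (suc N) + (u + v)) (⊛-*ˡ (f 0) (g ∘ suc) h N) (⊛-assoc (f ∘ suc) g h N) ⟩
    f 0 * g 0 * h (suc N) + (f 0 * ((g ∘ suc) ⊛ h) N + ((f ∘ suc) ⊛ (g ⊛ h)) N)
      ≡⟨ regroup (f 0) (g 0) (h (suc N)) (((g ∘ suc) ⊛ h) N) (((f ∘ suc) ⊛ (g ⊛ h)) N) ⟩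
    f 0 * (g 0 * h (suc N) + ((g ∘ suc) ⊛ h) N) + ((f ∘ suc) ⊛ (g ⊛ h)) N
      ≡⟨ cong (λ u → f 0 * u + ((f ∘ suc) ⊛ (g ⊛ h)) N) (sym (⊛-suc g h N)) ⟩
    f 0 * (g ⊛ h) (suc N) + ((f ∘ suc) ⊛ (g ⊛ h)) N
      ≡⟨ sym (⊛-suc f (g ⊛ h) N) ⟩
    (f ⊛ (g ⊛ h)) (suc N)
      ∎
    where
    open ≡-Reasoning
    regroup : ∀ a b c d e → a * b * c + (a * d + e) ≡ a * (b * c + d) + e
    regroup = solve-∀

  ⊛-isCommutativeMonoid : IsCommutativeMonoid _≗_ _⊛_ one
  ⊛-isCommutativeMonoid = isCommutativeMonoidˡ record
    { isSemigroup = record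
      { isMagma = record
        { isEquivalence = record { refl = λ _ → refl ; sym = λ p x → sym (p x) ; trans = λ p q x → trans (p x) (q x) }
        ; ∙-cong        = ⊛-cong
        }
      ; assoc = ⊛-assoc
      }
    ; identityˡ = ⊛-identityˡ
    ; comm      = ⊛-comm
    }
    where open import Algebra.Structures.Biased _≗_ using (isCommutativeMonoidˡ)

  ⊛-commutativeMonoid : CommutativeMonoid 0ℓ 0ℓ
  ⊛-commutativeMonoid = record { isCommutativeMonoid = ⊛-isCommutativeMonoid }

module PowerSeriesFactors where

  open import Algebra.Bundles using (CommutativeMonoid)
  open import Data.Nat as ℕ using (ℕ; zero; suc; _<_; s≤s; _≟_)
  import Data.Nat.Properties as ℕ
  open import Data.Integer using (+_; -_; _+_; _*_)
  open import Data.Integer.Properties hiding (_≟_)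
  open import Data.List using (List; []; _∷_; _++_; map; foldr; upTo; applyUpTo)
  open import Data.List.Properties using (map-++; map-∘; map-cong; map-applyUpTo; map-upTo)
  open import Data.Empty using (⊥-elim)
  open import Function using (_∘_; id)
  open import Relation.Nullary using (yes; no; ¬_)
  open import Relation.Binary.PropositionalEquality
  open import Data.Integer.Tactic.RingSolver using (solve-∀)
  open import Defs
  open Sums
  open PowerSeries
  open ℤΣ
  open CommutativeMonoid ⊛-commutativeMonoid using () renaming (setoid to ⊛-setoid; identityʳ to ⊛-identityʳ; trans to ≗-trans; commutativeSemigroup to ⊛-commutativeSemigroup)
  open import Algebra.Properties.CommutativeSemigroup ⊛-commutativeSemigroup using (interchange)
  import Relation.Binary.Reasoning.Setoid ⊛-setoid as ≗-Reasoning

  xPow-≡ : ∀ {n m} → n ≡ m → xPow n m ≡ + 1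
  xPow-≡ {n} {m} n≡m with n ≟ m
  ... | yes _   = refl
  ... | no n≢m = ⊥-elim (n≢m n≡m)

  xPow-≢ : ∀ {n m} → ¬ n ≡ m → xPow n m ≡ + 0
  xPow-≢ {n} {m} n≢m with n ≟ m
  ... | yes n≡m = ⊥-elim (n≢m n≡m)
  ... | no _    = refl

  xPow-suc : ∀ n M → xPow (suc n) (suc M) ≡ xPow n M
  xPow-suc n M with n ≟ M
  ... | yes n≡M = xPow-≡ (cong suc n≡M)
  ... | no n≢M  = xPow-≢ (n≢M ∘ ℕ.suc-injective)

  xPow-zero : xPow 0 ≗ one
  xPow-zero zero    = refl
  xPow-zero (suc N) = refl

  X : Series
  X = xPow 1

  X⊛-zero : ∀ f → (X ⊛ f) 0 ≡ + 0
  X⊛-zero f = trans (⊛-zero X f) (*-zeroˡ (f 0))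

  X⊛-suc : ∀ f N → (X ⊛ f) (suc N) ≡ f N
  X⊛-suc f N = begin
    (X ⊛ f) (suc N)                      ≡⟨ ⊛-suc X f N ⟩
    + 0 * f (suc N) + ((X ∘ suc) ⊛ f) N   ≡⟨ cong₂ _+_ (*-zeroˡ (f (suc N))) (⊛-congʳ f (λ i → trans (xPow-suc 0 i) (xPow-zero i)) N) ⟩
    + 0 + (one ⊛ f) N                    ≡⟨ trans (+-identityˡ _) (⊛-identityˡ f N) ⟩
    f N                                  ∎
    where open ≡-Reasoning

  xPow-suc≗ : ∀ n → xPow (suc n) ≗ (X ⊛ xPow n)
  xPow-suc≗ n zero    = sym (X⊛-zero (xPow n))
  xPow-suc≗ n (suc N) = trans (xPow-suc n N) (sym (X⊛-suc (xPow n) N))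

  xPow⊛-below : ∀ k f {N} → N < k → (xPow k ⊛ f) N ≡ + 0
  xPow⊛-below (suc k) f {zero}  _         = trans (⊛-congʳ f (xPow-suc≗ k) 0)
                                              (trans (⊛-assoc X (xPow k) f 0) (X⊛-zero (xPow k ⊛ f)))
  xPow⊛-below (suc k) f {suc N} (s≤s N<k) = trans (⊛-congʳ f (xPow-suc≗ k) (suc N))
                                              (trans (⊛-assoc X (xPow k) f (suc N))
                                                     (trans (X⊛-suc (xPow k ⊛ f) N) (xPow⊛-below k f N<k)))

  xPow-+ : ∀ k j → xPow (k ℕ.+ j) ≗ (xPow k ⊛ xPow j)
  xPow-+ zero    j = begin
    xPow j                ≈⟨ ⊛-identityˡ (xPow j) ⟨
    one ⊛ xPow j          ≈⟨ ⊛-congʳ (xPow j) xPow-zero ⟨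
    xPow 0 ⊛ xPow j       ∎
    where open ≗-Reasoning
  xPow-+ (suc k) j = begin
    xPow (suc k ℕ.+ j)        ≈⟨ xPow-suc≗ (k ℕ.+ j) ⟩
    X ⊛ xPow (k ℕ.+ j)        ≈⟨ ⊛-congˡ X (xPow-+ k j) ⟩
    X ⊛ (xPow k ⊛ xPow j)     ≈⟨ ⊛-assoc X (xPow k) (xPow j) ⟨
    (X ⊛ xPow k) ⊛ xPow j     ≈⟨ ⊛-congʳ (xPow j) (xPow-suc≗ k) ⟨
    xPow (suc k) ⊛ xPow j     ∎
    where open ≗-Reasoning

  powS-+ : ∀ f k j → powS f (k ℕ.+ j) ≗ (powS f k ⊛ powS f j)
  powS-+ f zero    j = λ N → sym (⊛-identityˡ (powS f j) N)
  powS-+ f (suc k) j = begin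
    f ⊛ powS f (k ℕ.+ j)          ≈⟨ ⊛-congˡ f (powS-+ f k j) ⟩
    f ⊛ (powS f k ⊛ powS f j)     ≈⟨ ⊛-assoc f (powS f k) (powS f j) ⟨
    (f ⊛ powS f k) ⊛ powS f j     ∎
    where open ≗-Reasoning

  ∏ : List Series → Series
  ∏ = foldr _⊛_ one

  ∏-++ : ∀ fs gs → ∏ (fs ++ gs) ≗ (∏ fs ⊛ ∏ gs)
  ∏-++ []       gs = λ N → sym (⊛-identityˡ (∏ gs) N)
  ∏-++ (f ∷ fs) gs = begin
    f ⊛ ∏ (fs ++ gs)         ≈⟨ ⊛-congˡ f (∏-++ fs gs) ⟩
    f ⊛ (∏ fs ⊛ ∏ gs)        ≈⟨ ⊛-assoc f (∏ fs) (∏ gs) ⟨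
    (f ⊛ ∏ fs) ⊛ ∏ gs        ∎
    where open ≗-Reasoning

  invProduct : ℕ → ℕ → Series
  invProduct m n = ∏ (map (λ t → invOnePlus (suc (m ℕ.+ t))) (upTo n))

  invProduct-+ : ∀ m k j → invProduct m (k ℕ.+ j) ≗ (invProduct m k ⊛ invProduct (m ℕ.+ k) j)
  invProduct-+ m k j N = trans (cong (λ fs → ∏ fs N) factors) (∏-++ (map φ (upTo k)) _ N)
    where
    φ : ℕ → Series
    φ t = invOnePlus (suc (m ℕ.+ t))
    factors : map φ (upTo (k ℕ.+ j)) ≡ map φ (upTo k) ++ map (λ t → invOnePlus (suc (m ℕ.+ k ℕ.+ t))) (upTo j)
    factors = begin
      map φ (upTo (k ℕ.+ j))                          ≡⟨ cong (map φ) (applyUpTo-+ id k j) ⟩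
      map φ (upTo k ++ applyUpTo (k ℕ.+_) j)          ≡⟨ map-++ φ (upTo k) _ ⟩
      map φ (upTo k) ++ map φ (applyUpTo (k ℕ.+_) j)  ≡⟨ cong (map φ (upTo k) ++_) (trans (map-applyUpTo (k ℕ.+_) φ j) (sym (map-upTo _ j))) ⟩
      map φ (upTo k) ++ map (φ ∘ (k ℕ.+_)) (upTo j)   ≡⟨ cong (map φ (upTo k) ++_) (map-cong (λ t → cong (invOnePlus ∘ suc) (sym (ℕ.+-assoc m k t))) (upTo j)) ⟩
      map φ (upTo k) ++ map (λ t → invOnePlus (suc (m ℕ.+ k ℕ.+ t))) (upTo j) ∎
      where open ≡-Reasoning

  gfTermFrom : ℕ → ℕ → Series
  gfTermFrom m n = xPow n ⊛ (powS oneMinusX n ⊛ invProduct m n)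

  gfTerm≗gfTermFrom : ∀ n → gfTerm n ≗ gfTermFrom 0 n
  gfTerm≗gfTermFrom n = ⊛-congˡ (xPow n) (⊛-congˡ (powS oneMinusX n) (λ N → cong (λ fs → ∏ fs N) (sym (map-∘ (upTo n)))))

  gfTermFrom-+ : ∀ m k j → gfTermFrom m (k ℕ.+ j) ≗ (gfTermFrom m k ⊛ gfTermFrom (m ℕ.+ k) j)
  gfTermFrom-+ m k j = begin
    xPow (k ℕ.+ j) ⊛ (powS oneMinusX (k ℕ.+ j) ⊛ invProduct m (k ℕ.+ j))
      ≈⟨ ⊛-cong (xPow-+ k j) (⊛-cong (powS-+ oneMinusX k j) (invProduct-+ m k j)) ⟩
    (xPow k ⊛ xPow j) ⊛ ((powS oneMinusX k ⊛ powS oneMinusX j) ⊛ (invProduct m k ⊛ invProduct (m ℕ.+ k) j))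
      ≈⟨ ⊛-congˡ (xPow k ⊛ xPow j) (interchange (powS oneMinusX k) _ _ _) ⟩
    (xPow k ⊛ xPow j) ⊛ ((powS oneMinusX k ⊛ invProduct m k) ⊛ (powS oneMinusX j ⊛ invProduct (m ℕ.+ k) j))
      ≈⟨ interchange (xPow k) _ _ _ ⟩
    gfTermFrom m k ⊛ gfTermFrom (m ℕ.+ k) j
      ∎
    where open ≗-Reasoning

  gfTermFrom-below : ∀ m k {N} → N < k → gfTermFrom m k N ≡ + 0
  gfTermFrom-below m k = xPow⊛-below k (powS oneMinusX k ⊛ invProduct m k)

  gfTermFrom-zero : ∀ m → gfTermFrom m 0 ≗ one
  gfTermFrom-zero m = begin
    xPow 0 ⊛ (one ⊛ one)   ≈⟨ ⊛-congʳ (one ⊛ one) xPow-zero ⟩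
    one ⊛ (one ⊛ one)      ≈⟨ ⊛-identityˡ (one ⊛ one) ⟩
    one ⊛ one              ≈⟨ ⊛-identityˡ one ⟩
    one                    ∎
    where open ≗-Reasoning

  onePlus : ℕ → Series
  onePlus ℓ i = one i + + ℓ * X i

  onePlus⊛-zero : ∀ ℓ f → (onePlus ℓ ⊛ f) 0 ≡ f 0
  onePlus⊛-zero ℓ f = begin
    (onePlus ℓ ⊛ f) 0                        ≡⟨ ⊛-distribʳ one (λ i → + ℓ * X i) f 0 ⟩
    (one ⊛ f) 0 + ((λ i → + ℓ * X i) ⊛ f) 0   ≡⟨ cong₂ _+_ (⊛-identityˡ f 0) (trans (⊛-*ˡ (+ ℓ) X f 0) (cong (+ ℓ *_) (X⊛-zero f))) ⟩
    f 0 + + ℓ * + 0                          ≡⟨ cong (λ u → f 0 + u) (*-zeroʳ (+ ℓ)) ⟩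
    f 0 + + 0                                ≡⟨ +-identityʳ (f 0) ⟩
    f 0                                      ∎
    where open ≡-Reasoning

  onePlus⊛-suc : ∀ ℓ f N → (onePlus ℓ ⊛ f) (suc N) ≡ f (suc N) + + ℓ * f N
  onePlus⊛-suc ℓ f N = trans (⊛-distribʳ one (λ i → + ℓ * X i) f (suc N))
    (cong₂ _+_ (⊛-identityˡ f (suc N)) (trans (⊛-*ˡ (+ ℓ) X f (suc N)) (cong (+ ℓ *_) (X⊛-suc f N))))

  invOnePlus⊛onePlus : ∀ ℓ → (invOnePlus ℓ ⊛ onePlus ℓ) ≗ one
  invOnePlus⊛onePlus ℓ zero    = trans (⊛-comm (invOnePlus ℓ) (onePlus ℓ) 0) (onePlus⊛-zero ℓ (invOnePlus ℓ))
  invOnePlus⊛onePlus ℓ (suc N) = trans (⊛-comm (invOnePlus ℓ) (onePlus ℓ) (suc N))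
    (trans (onePlus⊛-suc ℓ (invOnePlus ℓ) N) (cancel (+ ℓ) (invOnePlus ℓ N)))
    where
    cancel : ∀ a b → (- a) * b + a * b ≡ + 0
    cancel = solve-∀

  ones : Series
  ones _ = + 1

  oneMinusX⊛ones : (oneMinusX ⊛ ones) ≗ one
  oneMinusX⊛ones zero    = refl
  oneMinusX⊛ones (suc N) = begin
    (oneMinusX ⊛ ones) (suc N)                       ≡⟨ ⊛-suc oneMinusX ones N ⟩
    + 1 * + 1 + ((oneMinusX ∘ suc) ⊛ ones) N          ≡⟨ cong (λ u → + 1 + u) (⊛-congʳ ones tail N) ⟩
    + 1 + ((λ i → - + 1 * one i) ⊛ ones) N            ≡⟨ cong (λ u → + 1 + u) (trans (⊛-*ˡ (- + 1) one ones N) (cong (- + 1 *_) (⊛-identityˡ ones N))) ⟩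
    + 0                                               ∎
    where
    open ≡-Reasoning
    tail : (oneMinusX ∘ suc) ≗ (λ i → - + 1 * one i)
    tail zero    = refl
    tail (suc i) = refl

  onePlus⊛ones-zero : ∀ m → (onePlus m ⊛ ones) 0 ≡ + 1
  onePlus⊛ones-zero m = onePlus⊛-zero m ones

  onePlus⊛ones-suc : ∀ m N → (onePlus m ⊛ ones) (suc N) ≡ + suc m
  onePlus⊛ones-suc m N = trans (onePlus⊛-suc m ones N) (cong (λ u → + 1 + u) (*-identityʳ (+ m)))

  gfTermFrom-suc⊛ : ∀ m t → (gfTermFrom m (suc t) ⊛ (onePlus (m ℕ.+ suc t) ⊛ ones)) ≗ (X ⊛ gfTermFrom m t)
  gfTermFrom-suc⊛ m t = begin
    gfTermFrom m (suc t) ⊛ (onePlus (m ℕ.+ suc t) ⊛ ones)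
      ≈⟨ ⊛-cong split (⊛-congʳ ones (λ i → cong (λ k → onePlus k i) (ℕ.+-suc m t))) ⟩
    (E ⊛ (X ⊛ ((oneMinusX ⊛ one) ⊛ (invOnePlus (suc (m ℕ.+ t ℕ.+ 0)) ⊛ one)))) ⊛ (onePlus ℓ ⊛ ones)
      ≈⟨ ⊛-congʳ (onePlus ℓ ⊛ ones) (⊛-congˡ E (⊛-congˡ X (⊛-cong (⊛-identityʳ oneMinusX) (≗-trans (⊛-identityʳ _) last-factor)))) ⟩
    (E ⊛ (X ⊛ (oneMinusX ⊛ invOnePlus ℓ))) ⊛ (onePlus ℓ ⊛ ones)
      ≈⟨ solve 6 (λ e x o i p s → (e ⊕ (x ⊕ (o ⊕ i))) ⊕ (p ⊕ s) ⊜ (x ⊕ e) ⊕ ((o ⊕ s) ⊕ (i ⊕ p))) (λ _ → refl)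
               E X oneMinusX (invOnePlus ℓ) (onePlus ℓ) ones ⟩
    (X ⊛ E) ⊛ ((oneMinusX ⊛ ones) ⊛ (invOnePlus ℓ ⊛ onePlus ℓ))
      ≈⟨ ⊛-congˡ (X ⊛ E) (≗-trans (⊛-cong oneMinusX⊛ones (invOnePlus⊛onePlus ℓ)) (⊛-identityˡ one)) ⟩
    (X ⊛ E) ⊛ one
      ≈⟨ ⊛-identityʳ (X ⊛ E) ⟩
    X ⊛ E
      ∎
    where
    open ≗-Reasoning
    open import Algebra.Solver.CommutativeMonoid ⊛-commutativeMonoid using (solve; _⊜_; _⊕_)
    E : Series
    E = gfTermFrom m t
    ℓ : ℕ
    ℓ = suc (m ℕ.+ t)
    split : gfTermFrom m (suc t) ≗ (E ⊛ gfTermFrom (m ℕ.+ t) 1)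
    split N = trans (cong (λ k → gfTermFrom m k N) (ℕ.+-comm 1 t)) (gfTermFrom-+ m t 1 N)
    last-factor : invOnePlus (suc (m ℕ.+ t ℕ.+ 0)) ≗ invOnePlus ℓ
    last-factor N = cong (λ k → invOnePlus (suc k) N) (ℕ.+-identityʳ (m ℕ.+ t))

module CatalanPaths where

  open import Data.Bool using (Bool; true; false)
  open import Data.Nat using (ℕ; zero; suc; _+_; _*_; _∸_; _≤_; z≤n; s≤s; s≤s⁻¹)
  open import Data.Nat.Properties using (+-identityʳ; +-suc; suc-injective; *-zeroʳ)
  open import Data.List using (List; []; _∷_; map; length; take; drop; upTo)
  open import Data.List.Properties using (map-applyUpTo; map-∘; map-cong)
  open import Data.Nat.ListAction using (sum; product)
  open import Data.Product using (_×_; _,_)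
  open import Data.Sum using (inj₁; inj₂)
  open import Function using (id; _∘_; _⇔_; mk⇔; Equivalence)
  open import Relation.Nullary using (¬_)
  open import Relation.Binary.PropositionalEquality
  open import Defs
  open Sums
  open ℕΣ

  runFactor : Bool → ℕ → ℕ
  runFactor true  k = suc k
  runFactor false k = 1

  -- The weight of a step sequence read from height h with r up-steps still to come: closing an
  -- up-run (a D right after a U, recorded by b) multiplies by 1 + m + (up-steps still to come).
  pathWeight : List Step → (h r : ℕ) → Bool → ℕ → ℕ
  pathWeight []      zero    zero    b m = 1
  pathWeight []      zero    (suc r) b m = 0
  pathWeight []      (suc h) r       b m = 0
  pathWeight (U ∷ s) h       zero    b m = 0
  pathWeight (U ∷ s) h       (suc r) b m = pathWeight s (suc h) r true m
  pathWeight (D ∷ s) zero    r       b m = 0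
  pathWeight (D ∷ s) (suc h) r       b m = runFactor b (r + m) * pathWeight s h r false m

  mutual
    pathSum : ℕ → (h r : ℕ) → Bool → ℕ → ℕ
    pathSum zero    zero    zero    b m = 1
    pathSum zero    zero    (suc r) b m = 0
    pathSum zero    (suc h) r       b m = 0
    pathSum (suc L) h       r       b m = upStepSum L h r m + downStepSum L h r b m

    upStepSum : ℕ → (h r : ℕ) → ℕ → ℕ
    upStepSum L h zero    m = 0
    upStepSum L h (suc r) m = pathSum L (suc h) r true m

    downStepSum : ℕ → (h r : ℕ) → Bool → ℕ → ℕ
    downStepSum L zero    r b m = 0
    downStepSum L (suc h) r b m = runFactor b (r + m) * pathSum L h r false m

  ∑-pathWeight : ∀ L h r b m → ∑ (λ s → pathWeight s h r b m) (allSteps L) ≡ pathSum L h r b m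
  ∑-pathWeight zero    zero    zero    b m = refl
  ∑-pathWeight zero    zero    (suc r) b m = refl
  ∑-pathWeight zero    (suc h) r       b m = refl
  ∑-pathWeight (suc L) h       r       b m = begin
    ∑ (λ s → pathWeight s h r b m) (allSteps (suc L))
      ≡⟨ ∑-concatMap _ (λ s → (U ∷ s) ∷ (D ∷ s) ∷ []) (allSteps L) ⟩
    ∑ (λ s → up s + (down s + 0)) (allSteps L)
      ≡⟨ ∑-cong (allSteps L) (λ s → cong (up s +_) (+-identityʳ (down s))) ⟩
    ∑ (λ s → up s + down s) (allSteps L)
      ≡⟨ ∑-+ up down (allSteps L) ⟩
    ∑ up (allSteps L) + ∑ down (allSteps L)
      ≡⟨ cong₂ _+_ (∑-up h r) (∑-down h r) ⟩
    upStepSum L h r m + downStepSum L h r b m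
      ∎
    where
    open ≡-Reasoning
    up down : List Step → ℕ
    up   s = pathWeight (U ∷ s) h r b m
    down s = pathWeight (D ∷ s) h r b m
    ∑-up : ∀ h r → ∑ (λ s → pathWeight (U ∷ s) h r b m) (allSteps L) ≡ upStepSum L h r m
    ∑-up h zero    = ∑-zero (allSteps L)
    ∑-up h (suc r) = ∑-pathWeight L (suc h) r true m
    ∑-down : ∀ h r → ∑ (λ s → pathWeight (D ∷ s) h r b m) (allSteps L) ≡ downStepSum L h r b m
    ∑-down zero    r = ∑-zero (allSteps L)
    ∑-down (suc h) r = trans (∑-*ˡ (runFactor b (r + m)) _ (allSteps L))
                             (cong (runFactor b (r + m) *_) (∑-pathWeight L h r false m))

  DyckSuffix : List Step → (h r : ℕ) → Set
  DyckSuffix s h r = countU s ≡ r × countD s ≡ h + r × (∀ k → countD (take k s) ≤ h + countU (take k s))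

  DyckSuffix-U : ∀ {s h r} → DyckSuffix (U ∷ s) h (suc r) ⇔ DyckSuffix s (suc h) r
  DyckSuffix-U {s} {h} {r} = mk⇔
    (λ (#U , #D , bounded) → suc-injective #U , trans #D (+-suc h r) ,
                             λ k → subst (countD (take k s) ≤_) (+-suc h _) (bounded (suc k)))
    (λ (#U , #D , bounded) → cong suc #U , trans #D (sym (+-suc h r)) , λ where
       zero    → z≤n
       (suc k) → subst (countD (take k s) ≤_) (sym (+-suc h _)) (bounded k))

  DyckSuffix-D : ∀ {s h r} → DyckSuffix (D ∷ s) (suc h) r ⇔ DyckSuffix s h r
  DyckSuffix-D = mk⇔
    (λ (#U , #D , bounded) → #U , suc-injective #D , λ k → s≤s⁻¹ (bounded (suc k)))
    (λ (#U , #D , bounded) → #U , cong suc #D , λ where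
       zero    → z≤n
       (suc k) → s≤s (bounded k))

  tailSumProduct : List ℕ → ℕ
  tailSumProduct []      = 1
  tailSumProduct (x ∷ v) = suc (sum v) * tailSumProduct v

  sum-upRunsAcc : ∀ k s → sum (upRunsAcc k s) ≡ k + countU s
  sum-upRunsAcc zero    []      = refl
  sum-upRunsAcc (suc k) []      = refl
  sum-upRunsAcc zero    (U ∷ s) = sum-upRunsAcc 1 s
  sum-upRunsAcc (suc k) (U ∷ s) = trans (sum-upRunsAcc (suc (suc k)) s) (cong suc (sym (+-suc k (countU s))))
  sum-upRunsAcc zero    (D ∷ s) = sum-upRunsAcc zero s
  sum-upRunsAcc (suc k) (D ∷ s) = cong (suc k +_) (sum-upRunsAcc zero s)

  runWeight : ℕ → List Step → ℕ
  runWeight k s = tailSumProduct (upRunsAcc k s)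

  inRun : ℕ → Bool
  inRun zero    = false
  inRun (suc _) = true

  runWeight-U : ∀ k s → runWeight k (U ∷ s) ≡ runWeight (suc k) s
  runWeight-U zero    s = refl
  runWeight-U (suc k) s = refl

  runWeight-D : ∀ k s → runWeight k (D ∷ s) ≡ runFactor (inRun k) (countU s) * runWeight 0 s
  runWeight-D zero    s = sym (+-identityʳ _)
  runWeight-D (suc k) s = cong (λ n → suc n * runWeight 0 s) (sum-upRunsAcc 0 s)

  pathWeight-restricts : ∀ s h r k →
    Restricts (λ s → DyckSuffix s h r) (runWeight k) (λ s → pathWeight s h r (inRun k) 0) s
  pathWeight-restricts [] zero zero zero    = inj₁ ((refl , refl , λ { zero → z≤n ; (suc _) → z≤n }) , refl)
  pathWeight-restricts [] zero zero (suc k) = inj₁ ((refl , refl , λ { zero → z≤n ; (suc _) → z≤n }) , refl)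
  pathWeight-restricts [] zero    (suc r) k = inj₂ ((λ ()) , refl)
  pathWeight-restricts [] (suc h) r       k = inj₂ ((λ ()) , refl)
  pathWeight-restricts (U ∷ s) h zero k = inj₂ ((λ ()) , refl)
  pathWeight-restricts (U ∷ s) h (suc r) k with pathWeight-restricts s (suc h) r (suc k)
  ... | inj₁ (dyck , weight) = inj₁ (Equivalence.from DyckSuffix-U dyck , trans weight (sym (runWeight-U k s)))
  ... | inj₂ (¬dyck , weight) = inj₂ (¬dyck ∘ Equivalence.to DyckSuffix-U , weight)
  pathWeight-restricts (D ∷ s) zero r k = inj₂ ((λ (_ , _ , bounded) → absurd (bounded 1)) , refl)
    where
    absurd : ¬ (1 ≤ 0)
    absurd ()
  pathWeight-restricts (D ∷ s) (suc h) r k with pathWeight-restricts s h r 0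
  ... | inj₁ (dyck@(#U , _) , weight) = inj₁ (Equivalence.from DyckSuffix-D dyck , (begin
    runFactor (inRun k) (r + 0) * pathWeight s h r false 0 ≡⟨ cong₂ (λ n w → runFactor (inRun k) n * w) (trans (+-identityʳ r) (sym #U)) weight ⟩
    runFactor (inRun k) (countU s) * runWeight 0 s          ≡⟨ sym (runWeight-D k s) ⟩
    runWeight k (D ∷ s)                                     ∎))
    where open ≡-Reasoning
  ... | inj₂ (¬dyck , weight) = inj₂ (¬dyck ∘ Equivalence.to DyckSuffix-D ,
    trans (cong (runFactor (inRun k) (r + 0) *_) weight) (*-zeroʳ (runFactor (inRun k) (r + 0))))

  ∑-at-fromTo : ∀ v j → ∑ (λ t → at v (suc (j + t))) (upTo (length v ∸ j)) ≡ sum (drop j v)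
  ∑-at-fromTo []      zero    = refl
  ∑-at-fromTo []      (suc j) = refl
  ∑-at-fromTo (x ∷ v) zero    = trans (∑-upTo-suc (λ t → at (x ∷ v) (suc t)) (length v)) (cong (x +_) (∑-at-fromTo v 0))
  ∑-at-fromTo (x ∷ v) (suc j) = ∑-at-fromTo v j

  ∏-upTo-suc : (g : ℕ → ℕ) (n : ℕ) → product (map g (upTo (suc n))) ≡ g 0 * product (map (g ∘ suc) (upTo n))
  ∏-upTo-suc g n = cong (λ xs → g 0 * product xs) (trans (map-applyUpTo suc g n) (sym (map-applyUpTo id (g ∘ suc) n)))

  tailSumProduct-drop : ∀ v → tailSumProduct v ≡ product (map (λ t → suc (sum (drop (suc t) v))) (upTo (length v ∸ 1)))
  tailSumProduct-drop []          = refl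
  tailSumProduct-drop (x ∷ [])    = refl
  tailSumProduct-drop (x ∷ y ∷ v) =
    trans (cong (suc (sum (y ∷ v)) *_) (tailSumProduct-drop (y ∷ v)))
          (sym (∏-upTo-suc (λ t → suc (sum (drop t (y ∷ v)))) (length v)))

  catWeight≡tailSumProduct : ∀ C → catWeight C ≡ tailSumProduct (w C)
  catWeight≡tailSumProduct C = trans (shape (w C)) (sym (tailSumProduct-drop (w C)))
    where
    shape : ∀ v → product (map (λ i → 1 + sum (map (at v) (fromTo i (length v)))) (fromTo 2 (length v)))
                ≡ product (map (λ t → suc (sum (drop (suc t) v))) (upTo (length v ∸ 1)))
    shape []      = refl
    shape (x ∷ v) = cong product (trans (sym (map-∘ (upTo (length v))))
      (map-cong (λ t → cong suc (trans (∑-map (at (x ∷ v)) (suc (suc t) +_) (upTo (length v ∸ t)))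
                                       (∑-at-fromTo (x ∷ v) (suc t))))
                (upTo (length v))))

module LastReturn where

  open import Data.Bool using (Bool; true; false)
  open import Data.Nat using (ℕ; zero; suc; _+_; _*_; _∸_; _≤_; _<_; s≤s)
  open import Data.Nat.Properties
  open import Data.List using (upTo)
  open import Data.List.Membership.Propositional.Properties using (∈-upTo⁻)
  open import Relation.Binary.PropositionalEquality
  open import Data.Product using (_×_; _,_; proj₂)
  open import Data.Sum using (inj₁; inj₂)
  open import Data.Nat.Tactic.RingSolver using (solve-∀)
  open import Defs
  open Sums
  open CatalanPaths
  open ℕΣ

  suffixSum : (h r : ℕ) → Bool → ℕ → ℕ
  suffixSum h r b m = pathSum (h + (r + r)) h r b m

  catalanSum : ℕ → ℕ → ℕ
  catalanSum n m = suffixSum 0 n false m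

  SumOver-catalanSum : ∀ n → SumOver (IsCatalan n) catWeight (allSteps (2 * n)) (catalanSum n 0)
  SumOver-catalanSum n =
    subst (SumOver (IsCatalan n) catWeight (allSteps (2 * n)))
          (trans (∑-pathWeight (2 * n) 0 n false 0) (cong (λ L → pathSum L 0 n false 0) (cong (n +_) (+-identityʳ n))))
          (SumOver-∑ (λ s → pathWeight s 0 n false 0) (allSteps (2 * n)) (λ {s} _ → restricts s))
    where
    restricts : ∀ s → Restricts (IsCatalan n) catWeight (λ s → pathWeight s 0 n false 0) s
    restricts s with pathWeight-restricts s 0 n 0
    ... | inj₁ (catalan , weight) = inj₁ (catalan , trans weight (sym (catWeight≡tailSumProduct s)))
    ... | inj₂ not-catalan        = inj₂ not-catalan

  WeightFamily : Set
  WeightFamily = (h r : ℕ) → Bool → ℕ → ℕ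

  upStep : WeightFamily → (h r : ℕ) → ℕ → ℕ
  upStep F h zero    m = 0
  upStep F h (suc r) m = F (suc h) r true m

  StepRecursive : WeightFamily → Set
  StepRecursive F = ∀ h r b m → F (suc h) r b m ≡ upStep F (suc h) r m + runFactor b (r + m) * F h r false m

  Grounded : WeightFamily → Set
  Grounded F = (∀ b m → F 0 0 b m ≡ 1) × (∀ r b m → F 0 (suc r) b m ≡ F 1 r true m)

  private
    length-U : ∀ h r → h + (suc r + suc r) ≡ suc (suc h + (r + r))
    length-U h r = trans (+-suc h (r + suc r)) (cong suc (trans (cong (h +_) (+-suc r r)) (+-suc h (r + r))))

  suffixSum-U : ∀ h r b m → suffixSum h (suc r) b m ≡ suffixSum (suc h) r true m + downStepSum (suc h + (r + r)) h (suc r) b m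
  suffixSum-U h r b m = cong (λ L → pathSum L h (suc r) b m) (length-U h r)

  suffixSum-stepRecursive : StepRecursive suffixSum
  suffixSum-stepRecursive h zero    b m = refl
  suffixSum-stepRecursive h (suc r) b m = trans (suffixSum-U (suc h) r b m)
    (cong (λ L → suffixSum (suc (suc h)) r true m + runFactor b (suc r + m) * pathSum L h (suc r) false m) (sym (length-U h r)))

  suffixSum-grounded : Grounded suffixSum
  suffixSum-grounded = (λ b m → refl) , (λ r b m → trans (suffixSum-U 0 r b m) (+-identityʳ _))

  StepRecursive-unique : ∀ {F} → StepRecursive F → Grounded F → ∀ h r b m → F h r b m ≡ suffixSum h r b m
  StepRecursive-unique {F} step (F-ground , F-groundU) h r b m = go (h + (r + r)) h r b m ≤-refl
    where
    open ≡-Reasoning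
    go : ∀ N h r b m → h + (r + r) ≤ N → F h r b m ≡ suffixSum h r b m
    go N       zero    zero    b m _           = F-ground b m
    go (suc N) zero    (suc r) b m (s≤s bound) = begin
      F 0 (suc r) b m          ≡⟨ F-groundU r b m ⟩
      F 1 r true m             ≡⟨ go N 1 r true m (subst (_≤ N) (+-suc r r) bound) ⟩
      suffixSum 1 r true m     ≡⟨ sym (proj₂ suffixSum-grounded r b m) ⟩
      suffixSum 0 (suc r) b m  ∎
    go (suc N) (suc h) r       b m (s≤s bound) = begin
      F (suc h) r b m                                                           ≡⟨ step h r b m ⟩
      upStep F (suc h) r m + runFactor b (r + m) * F h r false m                 ≡⟨ cong₂ (λ u v → u + runFactor b (r + m) * v) (go-up r bound) (go N h r false m bound) ⟩
      upStep suffixSum (suc h) r m + runFactor b (r + m) * suffixSum h r false m ≡⟨ sym (suffixSum-stepRecursive h r b m) ⟩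
      suffixSum (suc h) r b m                                                   ∎
      where
      go-up : ∀ r → h + (r + r) ≤ N → upStep F (suc h) r m ≡ upStep suffixSum (suc h) r m
      go-up zero    _     = refl
      go-up (suc r) bound = go N (suc (suc h)) r true m (subst (_≤ N) (length-U h r) bound)

  suffixSum-flat : ∀ h m → suffixSum h 0 false m ≡ 1
  suffixSum-flat zero    m = refl
  suffixSum-flat (suc h) m = trans (suffixSum-stepRecursive h 0 false m) (trans (+-identityʳ _) (suffixSum-flat h m))

  _⊕_ : WeightFamily → WeightFamily → WeightFamily
  (F ⊕ G) h r b m = F h r b m + G h r b m

  StepRecursive-⊕ : ∀ {F G} → StepRecursive F → StepRecursive G → StepRecursive (F ⊕ G)
  StepRecursive-⊕ {F} {G} F-step G-step h r b m =
    trans (cong₂ _+_ (F-step h r b m) (G-step h r b m))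
          (trans (regroup (upStep F (suc h) r m) (upStep G (suc h) r m) (runFactor b (r + m)) (F h r false m) (G h r false m))
                 (cong (_+ runFactor b (r + m) * (F ⊕ G) h r false m) (upStep-⊕ r)))
    where
    regroup : ∀ u v c x y → (u + c * x) + (v + c * y) ≡ (u + v) + c * (x + y)
    regroup = solve-∀
    upStep-⊕ : ∀ r → upStep F (suc h) r m + upStep G (suc h) r m ≡ upStep (F ⊕ G) (suc h) r m
    upStep-⊕ zero    = refl
    upStep-⊕ (suc r) = refl

  -- Cut a suffix at its last return to the axis: either it touches the axis only at its end
  -- (firstReturnSum), or it ends with a prime path with t + 1 up-steps (weight primeSum (t + 1))
  -- whose up-steps raise the offset of everything before it by t + 1 (lastReturnSum).
  firstReturnSum : WeightFamily
  firstReturnSum zero          zero    b m = 1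
  firstReturnSum zero          (suc r) b m = 0
  firstReturnSum (suc zero)    zero    b m = runFactor b m
  firstReturnSum (suc zero)    (suc r) b m = suffixSum 0 (suc r) b m
  firstReturnSum (suc (suc h)) r       b m = suffixSum (suc h) r b m

  primeSum : ℕ → ℕ → ℕ
  primeSum k m = firstReturnSum 1 (k ∸ 1) true m

  firstReturnSum-false : ∀ h r m → firstReturnSum (suc h) r false m ≡ suffixSum h r false m
  firstReturnSum-false zero    zero    m = refl
  firstReturnSum-false zero    (suc r) m = refl
  firstReturnSum-false (suc h) r       m = refl

  firstReturnSum-stepRecursive : StepRecursive firstReturnSum
  firstReturnSum-stepRecursive zero zero b m = sym (*-identityʳ (runFactor b m))
  firstReturnSum-stepRecursive zero (suc r) b m =
    trans (proj₂ suffixSum-grounded r b m)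
          (sym (trans (cong (suffixSum 1 r true m +_) (*-zeroʳ (runFactor b (suc r + m)))) (+-identityʳ _)))
  firstReturnSum-stepRecursive (suc h) r b m =
    trans (suffixSum-stepRecursive h r b m)
          (cong₂ (λ u v → u + runFactor b (r + m) * v) (upStep-shift r) (sym (firstReturnSum-false h r m)))
    where
    upStep-shift : ∀ r → upStep suffixSum (suc h) r m ≡ upStep firstReturnSum (suc (suc h)) r m
    upStep-shift zero    = refl
    upStep-shift (suc r) = refl

  lastReturnSum : WeightFamily
  lastReturnSum h r b m = ∑ (λ t → suffixSum h (r ∸ suc t) b (m + suc t) * primeSum (suc t) m) (upTo r)

  private
    ∸-suc-< : ∀ {t r} → t < r → r ∸ t ≡ suc (r ∸ suc t)
    ∸-suc-< {t} {suc r} (s≤s t≤r) = +-∸-assoc 1 t≤r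

    ∸-offset : ∀ {t r} m → t < r → (r ∸ suc t) + (m + suc t) ≡ r + m
    ∸-offset {t} {r} m t<r = trans (shuffle (r ∸ suc t) m (suc t)) (cong (_+ m) (m∸n+n≡m t<r))
      where
      shuffle : ∀ x m y → x + (m + y) ≡ (x + y) + m
      shuffle = solve-∀

  lastReturnSum-stepRecursive : StepRecursive lastReturnSum
  lastReturnSum-stepRecursive h r b m = begin
    lastReturnSum (suc h) r b m
      ≡⟨ ∑-cong-∈ (upTo r) (λ t∈ → split (∈-upTo⁻ t∈)) ⟩
    ∑ (λ t → up t * P t + c * (down t * P t)) (upTo r)
      ≡⟨ ∑-+ (λ t → up t * P t) (λ t → c * (down t * P t)) (upTo r) ⟩
    ∑ (λ t → up t * P t) (upTo r) + ∑ (λ t → c * (down t * P t)) (upTo r)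
      ≡⟨ cong₂ _+_ (∑-up r) (∑-*ˡ c (λ t → down t * P t) (upTo r)) ⟩
    upStep lastReturnSum (suc h) r m + c * lastReturnSum h r false m
      ∎
    where
    open ≡-Reasoning
    c : ℕ
    c = runFactor b (r + m)
    P up down : ℕ → ℕ
    P    t = primeSum (suc t) m
    up   t = upStep suffixSum (suc h) (r ∸ suc t) (m + suc t)
    down t = suffixSum h (r ∸ suc t) false (m + suc t)
    split : ∀ {t} → t < r → suffixSum (suc h) (r ∸ suc t) b (m + suc t) * P t ≡ up t * P t + c * (down t * P t)
    split {t} t<r = begin
      suffixSum (suc h) (r ∸ suc t) b (m + suc t) * P t
        ≡⟨ cong (_* P t) (suffixSum-stepRecursive h (r ∸ suc t) b (m + suc t)) ⟩
      (up t + runFactor b (r ∸ suc t + (m + suc t)) * down t) * P t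
        ≡⟨ cong (λ k → (up t + runFactor b k * down t) * P t) (∸-offset m t<r) ⟩
      (up t + c * down t) * P t
        ≡⟨ *-distribʳ-+ (P t) (up t) (c * down t) ⟩
      up t * P t + c * down t * P t
        ≡⟨ cong (up t * P t +_) (*-assoc c (down t) (P t)) ⟩
      up t * P t + c * (down t * P t)
        ∎
    ∑-up : ∀ r → ∑ (λ t → upStep suffixSum (suc h) (r ∸ suc t) (m + suc t) * P t) (upTo r) ≡ upStep lastReturnSum (suc h) r m
    ∑-up zero    = refl
    ∑-up (suc r) = begin
      ∑ (λ t → upStep suffixSum (suc h) (r ∸ t) (m + suc t) * P t) (upTo (suc r))
        ≡⟨ ∑-upTo-∷ʳ _ r ⟩
      ∑ (λ t → upStep suffixSum (suc h) (r ∸ t) (m + suc t) * P t) (upTo r) + upStep suffixSum (suc h) (r ∸ r) (m + suc r) * P r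
        ≡⟨ cong₂ _+_ (∑-cong-∈ (upTo r) (λ {t} t∈ → cong (λ k → upStep suffixSum (suc h) k (m + suc t) * P t) (∸-suc-< (∈-upTo⁻ t∈))))
                     (cong (λ k → upStep suffixSum (suc h) k (m + suc r) * P r) (n∸n≡0 r)) ⟩
      lastReturnSum (suc (suc h)) r true m + 0
        ≡⟨ +-identityʳ _ ⟩
      upStep lastReturnSum (suc h) (suc r) m
        ∎

  firstReturn⊕lastReturn-grounded : Grounded (firstReturnSum ⊕ lastReturnSum)
  firstReturn⊕lastReturn-grounded = (λ b m → refl) , ground
    where
    open ≡-Reasoning
    ground : ∀ r b m → lastReturnSum 0 (suc r) b m ≡ firstReturnSum 1 r true m + lastReturnSum 1 r true m
    ground r b m = begin
      lastReturnSum 0 (suc r) b m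
        ≡⟨ ∑-upTo-∷ʳ _ r ⟩
      ∑ (λ t → suffixSum 0 (r ∸ t) b (m + suc t) * primeSum (suc t) m) (upTo r) + suffixSum 0 (r ∸ r) b (m + suc r) * primeSum (suc r) m
        ≡⟨ cong₂ _+_ (∑-cong-∈ (upTo r) (λ {t} t∈ → cong (_* primeSum (suc t) m) (grounded-∸ (∈-upTo⁻ t∈))))
                     (trans (cong (λ k → suffixSum 0 k b (m + suc r) * primeSum (suc r) m) (n∸n≡0 r)) (+-identityʳ _)) ⟩
      lastReturnSum 1 r true m + firstReturnSum 1 r true m
        ≡⟨ +-comm (lastReturnSum 1 r true m) (firstReturnSum 1 r true m) ⟩
      firstReturnSum 1 r true m + lastReturnSum 1 r true m
        ∎
      where
      grounded-∸ : ∀ {t} → t < r → suffixSum 0 (r ∸ t) b (m + suc t) ≡ suffixSum 1 (r ∸ suc t) true (m + suc t)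
      grounded-∸ {t} t<r = trans (cong (λ k → suffixSum 0 k b (m + suc t)) (∸-suc-< t<r)) (proj₂ suffixSum-grounded (r ∸ suc t) b (m + suc t))

  suffixSum-lastReturn : ∀ h r b m → suffixSum h r b m ≡ firstReturnSum h r b m + lastReturnSum h r b m
  suffixSum-lastReturn h r b m = sym (StepRecursive-unique
    (StepRecursive-⊕ firstReturnSum-stepRecursive lastReturnSum-stepRecursive) firstReturn⊕lastReturn-grounded h r b m)

  catalanSum-suc : ∀ n m → catalanSum (suc n) m ≡ ∑ (λ t → catalanSum (n ∸ t) (m + suc t) * primeSum (suc t) m) (upTo (suc n))
  catalanSum-suc n m = suffixSum-lastReturn 0 (suc n) false m

  primeSum-suc : ∀ j m → primeSum (suc (suc j)) m ≡ catalanSum (suc j) m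
  primeSum-suc j m = trans (proj₂ suffixSum-grounded j true m) (sym (proj₂ suffixSum-grounded j false m))

module FirstRuns where

  open import Data.Bool using (true; false)
  open import Data.Nat using (ℕ; zero; suc; _+_; _*_; _∸_; _≤_; _<_; z≤n; s≤s)
  open import Data.Nat.Properties
  open import Data.Nat.Induction using (<-rec)
  open import Data.List using (map; upTo)
  open import Data.List.Membership.Propositional.Properties using (∈-upTo⁻)
  open import Data.Nat.ListAction using (sum)
  open import Data.Product using (_,_; proj₂)
  open import Data.Sum using (inj₁; inj₂)
  open import Relation.Binary.PropositionalEquality
  open import Data.Nat.Tactic.RingSolver using (solve-∀)
  open import Defs
  open Sums
  open CatalanPaths
  open LastReturn
  open ℕΣ

  PRecSum : (ℕ → ℕ → ℕ) → ℕ → ℕ → ℕ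
  PRecSum p n k = sum (map (λ i → sum (map (λ j → p i j) (fromTo (k + 1 + i ∸ n) i))) (fromTo (n ∸ k) (n ∸ 1)))

  private
    lower-bound : ∀ {n k i} → k ≤ n → n ∸ k ≤ i → 1 ≤ k + 1 + i ∸ n
    lower-bound {n} {k} {i} k≤n n-k≤i = begin
      1                      ≡⟨ sym (m+n∸m≡n n 1) ⟩
      n + 1 ∸ n              ≡⟨ cong (_∸ n) (sym (trans (cong (_+ 1) (+-comm k (n ∸ k))) (cong (_+ 1) (m∸n+n≡m k≤n)))) ⟩
      k + (n ∸ k) + 1 ∸ n    ≤⟨ ∸-monoˡ-≤ n (subst (_≤ k + 1 + i) (+-assoc-comm k (n ∸ k) 1) (+-monoʳ-≤ (k + 1) n-k≤i)) ⟩
      k + 1 + i ∸ n          ∎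
      where
      open ≤-Reasoning
      +-assoc-comm : ∀ a b c → a + c + b ≡ a + b + c
      +-assoc-comm = solve-∀

    <⇒≤∸1 : ∀ {i n} → i < n → i ≤ n ∸ 1
    <⇒≤∸1 (s≤s i≤n) = i≤n

    ≤∸1⇒< : ∀ {i n} → 1 ≤ n → i ≤ n ∸ 1 → i < n
    ≤∸1⇒< {n = suc n} _ i≤n = s≤s i≤n

  PRec-unique : ∀ {p q} → PRec p → PRec q → ∀ n k → 1 ≤ k → k ≤ n → p n k ≡ q n k
  PRec-unique {p} {q} (p-diag , p-rec) (q-diag , q-rec) = <-rec _ agree
    where
    agree : ∀ n → (∀ {i} → i < n → ∀ j → 1 ≤ j → j ≤ i → p i j ≡ q i j) → ∀ k → 1 ≤ k → k ≤ n → p n k ≡ q n k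
    agree n IH k 1≤k k≤n with m≤n⇒m<n∨m≡n k≤n
    ... | inj₂ refl = trans (p-diag k 1≤k) (sym (q-diag k 1≤k))
    ... | inj₁ k<n  = trans (p-rec n k 1≤k k≤n-1) (trans (cong ((n ∸ k + 1) *_) sums-agree) (sym (q-rec n k 1≤k k≤n-1)))
      where
      k≤n-1 : k ≤ n ∸ 1
      k≤n-1 = <⇒≤∸1 k<n
      sums-agree : PRecSum p n k ≡ PRecSum q n k
      sums-agree = ∑-cong-∈ (fromTo (n ∸ k) (n ∸ 1)) λ {i} i∈ →
        let n-k≤i , i≤n-1 = ∈-fromTo⁻ (n ∸ k) (n ∸ 1) i∈
            i<n = ≤∸1⇒< (≤-trans 1≤k (<⇒≤ k<n)) i≤n-1
        in ∑-cong-∈ (fromTo (k + 1 + i ∸ n) i) λ {j} j∈ →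
          let lo , j≤i = ∈-fromTo⁻ (k + 1 + i ∸ n) i j∈
          in IH i<n j (≤-trans (lower-bound (<⇒≤ k<n) n-k≤i) lo) j≤i

  -- p_{n,k}: a first run of k up-steps closes with factor 1 + (n - k), leaving a suffix from height k - 1.
  firstRunSum : ℕ → ℕ → ℕ
  firstRunSum n k = (n ∸ k + 1) * suffixSum (k ∸ 1) (n ∸ k) false 0

  firstRunSum-shift : ∀ h R → firstRunSum (suc h + R) (suc h) ≡ (R + 1) * suffixSum h R false 0
  firstRunSum-shift h R = cong (λ z → (z + 1) * suffixSum h z false 0) (m+n∸m≡n h R)

  firstRunSum-diag : ∀ n → firstRunSum n n ≡ 1
  firstRunSum-diag n rewrite n∸n≡0 n = trans (+-identityʳ _) (suffixSum-flat (n ∸ 1) 0)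

  suffixSum-afterU : ∀ h R → suffixSum (suc h) R true 0 ≡ ∑ (λ t → firstRunSum (suc h + R) (suc h + t)) (upTo (suc R))
  suffixSum-afterU h zero = begin
    suffixSum (suc h) 0 true 0                  ≡⟨ suffixSum-stepRecursive h 0 true 0 ⟩
    1 * suffixSum h 0 false 0                   ≡⟨ cong (1 *_) (suffixSum-flat h 0) ⟩
    1                                           ≡⟨ sym (firstRunSum-diag (suc h)) ⟩
    firstRunSum (suc h) (suc h)                 ≡⟨ cong₂ firstRunSum (sym (+-identityʳ (suc h))) (sym (+-identityʳ (suc h))) ⟩
    firstRunSum (suc h + 0) (suc h + 0)         ≡⟨ sym (+-identityʳ _) ⟩
    ∑ (λ t → firstRunSum (suc h + 0) (suc h + t)) (upTo 1) ∎
    where open ≡-Reasoning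
  suffixSum-afterU h (suc R) = begin
    suffixSum (suc h) (suc R) true 0
      ≡⟨ suffixSum-stepRecursive h (suc R) true 0 ⟩
    suffixSum (suc (suc h)) R true 0 + suc (suc R + 0) * suffixSum h (suc R) false 0
      ≡⟨ cong₂ _+_ (suffixSum-afterU (suc h) R) (sym first) ⟩
    ∑ (λ t → firstRunSum (suc (suc h) + R) (suc (suc h) + t)) (upTo (suc R)) + firstRunSum (suc h + suc R) (suc h + 0)
      ≡⟨ +-comm (∑ (λ t → firstRunSum (suc (suc h) + R) (suc (suc h) + t)) (upTo (suc R))) _ ⟩
    firstRunSum (suc h + suc R) (suc h + 0) + ∑ (λ t → firstRunSum (suc (suc h) + R) (suc (suc h) + t)) (upTo (suc R))
      ≡⟨ cong (firstRunSum (suc h + suc R) (suc h + 0) +_)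
              (∑-cong (upTo (suc R)) (λ t → cong₂ firstRunSum (sym (+-suc (suc h) R)) (sym (+-suc (suc h) t)))) ⟩
    firstRunSum (suc h + suc R) (suc h + 0) + ∑ (λ t → firstRunSum (suc h + suc R) (suc h + suc t)) (upTo (suc R))
      ≡⟨ sym (∑-upTo-suc (λ t → firstRunSum (suc h + suc R) (suc h + t)) (suc R)) ⟩
    ∑ (λ t → firstRunSum (suc h + suc R) (suc h + t)) (upTo (suc (suc R)))
      ∎
    where
    open ≡-Reasoning
    first : firstRunSum (suc h + suc R) (suc h + 0) ≡ suc (suc R + 0) * suffixSum h (suc R) false 0
    first = trans (cong (firstRunSum (suc h + suc R)) (+-identityʳ (suc h)))
                  (trans (firstRunSum-shift h (suc R)) (cong (λ z → suc z * suffixSum h (suc R) false 0) (trans (+-comm R 1) (sym (+-identityʳ (suc R))))))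

  suffixSum-afterD : ∀ h R → suffixSum h (suc R) false 0 ≡ ∑ (λ j → suffixSum (suc j) R true 0) (upTo (suc h))
  suffixSum-afterD zero    R = trans (proj₂ suffixSum-grounded R false 0) (sym (+-identityʳ _))
  suffixSum-afterD (suc h) R = begin
    suffixSum (suc h) (suc R) false 0
      ≡⟨ suffixSum-stepRecursive h (suc R) false 0 ⟩
    suffixSum (suc (suc h)) R true 0 + (suffixSum h (suc R) false 0 + 0)
      ≡⟨ cong (suffixSum (suc (suc h)) R true 0 +_) (trans (+-identityʳ _) (suffixSum-afterD h R)) ⟩
    suffixSum (suc (suc h)) R true 0 + ∑ (λ j → suffixSum (suc j) R true 0) (upTo (suc h))
      ≡⟨ +-comm (suffixSum (suc (suc h)) R true 0) _ ⟩
    ∑ (λ j → suffixSum (suc j) R true 0) (upTo (suc h)) + suffixSum (suc (suc h)) R true 0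
      ≡⟨ sym (∑-upTo-∷ʳ (λ j → suffixSum (suc j) R true 0) (suc h)) ⟩
    ∑ (λ j → suffixSum (suc j) R true 0) (upTo (suc (suc h)))
      ∎
    where open ≡-Reasoning

  private
    fromTo-upTo : ∀ {a b c} → suc b ∸ a ≡ c → fromTo a b ≡ map (a +_) (upTo c)
    fromTo-upTo = cong (λ c → map (_ +_) (upTo c))

  PRecSum-firstRunSum : ∀ h R → PRecSum firstRunSum (suc h + suc R) (suc h) ≡ suffixSum h (suc R) false 0
  PRecSum-firstRunSum h R = begin
    PRecSum firstRunSum n (suc h)
      ≡⟨ cong (∑ inner) (trans (cong (λ a → fromTo a (n ∸ 1)) (m+n∸m≡n (suc h) (suc R))) (fromTo-upTo (outer-length h R))) ⟩
    ∑ inner (map (suc R +_) (upTo (suc h)))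
      ≡⟨ ∑-map inner (suc R +_) (upTo (suc h)) ⟩
    ∑ (λ j → inner (suc R + j)) (upTo (suc h))
      ≡⟨ ∑-cong (upTo (suc h)) inner-afterU ⟩
    ∑ (λ j → suffixSum (suc j) R true 0) (upTo (suc h))
      ≡⟨ sym (suffixSum-afterD h R) ⟩
    suffixSum h (suc R) false 0
      ∎
    where
    open ≡-Reasoning
    n : ℕ
    n = suc h + suc R
    outer-length : ∀ h R → suc (h + suc R) ∸ suc R ≡ suc h
    outer-length h R = trans (cong (_∸ suc R) (+-comm (suc h) (suc R))) (m+n∸m≡n (suc R) (suc h))
    inner-start : ∀ j → suc h + 1 + (suc R + j) ∸ n ≡ suc j
    inner-start j = trans (cong (_∸ n) (shuffle h R j)) (m+n∸m≡n n (suc j))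
      where
      shuffle : ∀ h R j → suc h + 1 + (suc R + j) ≡ (suc h + suc R) + suc j
      shuffle = solve-∀
    inner : ℕ → ℕ
    inner i = ∑ (firstRunSum i) (fromTo (suc h + 1 + i ∸ n) i)
    inner-afterU : ∀ j → inner (suc R + j) ≡ suffixSum (suc j) R true 0
    inner-afterU j = begin
      ∑ (firstRunSum (suc R + j)) (fromTo (suc h + 1 + (suc R + j) ∸ n) (suc R + j))
        ≡⟨ cong (λ a → ∑ (firstRunSum (suc R + j)) (fromTo a (suc R + j))) (inner-start j) ⟩
      ∑ (firstRunSum (suc R + j)) (fromTo (suc j) (suc R + j))
        ≡⟨ cong (∑ (firstRunSum (suc R + j))) (fromTo-upTo (m+n∸n≡m (suc R) j)) ⟩
      ∑ (firstRunSum (suc R + j)) (map (suc j +_) (upTo (suc R)))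
        ≡⟨ ∑-map (firstRunSum (suc R + j)) (suc j +_) (upTo (suc R)) ⟩
      ∑ (λ t → firstRunSum (suc R + j) (suc j + t)) (upTo (suc R))
        ≡⟨ ∑-cong (upTo (suc R)) (λ t → cong (λ z → firstRunSum (suc z) (suc j + t)) (+-comm R j)) ⟩
      ∑ (λ t → firstRunSum (suc j + R) (suc j + t)) (upTo (suc R))
        ≡⟨ sym (suffixSum-afterU j R) ⟩
      suffixSum (suc j) R true 0
        ∎

  firstRunSum-PRec : PRec firstRunSum
  firstRunSum-PRec = (λ n _ → firstRunSum-diag n) , rec
    where
    rec : ∀ n k → 1 ≤ k → k ≤ n ∸ 1 → firstRunSum n k ≡ (n ∸ k + 1) * PRecSum firstRunSum n k
    rec (suc n) (suc h) _ h<n = subst (λ n → firstRunSum n (suc h) ≡ (n ∸ suc h + 1) * PRecSum firstRunSum n (suc h))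
                                      (trans (+-suc (suc h) (n ∸ suc h)) (cong suc (m+[n∸m]≡n h<n)))
                                      (shifted h (n ∸ suc h))
      where
      shifted : ∀ h R → firstRunSum (suc h + suc R) (suc h) ≡ (suc h + suc R ∸ suc h + 1) * PRecSum firstRunSum (suc h + suc R) (suc h)
      shifted h R = trans (firstRunSum-shift h (suc R))
                     (cong₂ _*_ (cong (_+ 1) (sym (m+n∸m≡n (suc h) (suc R)))) (sym (PRecSum-firstRunSum h R)))

  catalanSum-PRec : ∀ (p : ℕ → ℕ → ℕ) → PRec p → ∀ n → 1 ≤ n → catalanSum n 0 ≡ sum (map (p n) (fromTo 1 n))
  catalanSum-PRec p p-rec (suc n) _ = begin
    catalanSum (suc n) 0                                  ≡⟨ proj₂ suffixSum-grounded n false 0 ⟩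
    suffixSum 1 n true 0                                  ≡⟨ suffixSum-afterU 0 n ⟩
    ∑ (λ t → firstRunSum (suc n) (suc t)) (upTo (suc n))  ≡⟨ ∑-cong-∈ (upTo (suc n)) (λ t∈ →
                                                               PRec-unique firstRunSum-PRec p-rec (suc n) _ (s≤s z≤n) (∈-upTo⁻ t∈)) ⟩
    ∑ (λ t → p (suc n) (suc t)) (upTo (suc n))            ≡⟨ sym (∑-map (p (suc n)) suc (upTo (suc n))) ⟩
    sum (map (p (suc n)) (fromTo 1 (suc n)))              ∎
    where open ≡-Reasoning

module GeneratingFunction where

  open import Data.Nat as ℕ using (ℕ; zero; suc; _∸_; _<_; _≤_; s≤s; s≤s⁻¹; _<?_)
  import Data.Nat.Properties as ℕ
  open import Data.Nat.Induction using (<-rec)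
  open import Data.Integer using (ℤ; +_; -_; _+_; _*_)
  open import Data.Integer.Properties hiding (_≟_; _<?_)
  open import Data.List using (List; []; _∷_; upTo)
  open import Data.List.Membership.Propositional.Properties using (∈-upTo⁻)
  open import Function using (_∘_)
  open import Relation.Nullary using (yes; no)
  open import Relation.Binary.PropositionalEquality
  open import Data.Integer.Tactic.RingSolver using (solve-∀)
  open import Defs
  open Sums
  open PowerSeries
  open PowerSeriesFactors
  open LastReturn
  open ℤΣ

  +-∑ : {A : Set} (f : A → ℕ) (xs : List A) → + ℕΣ.∑ f xs ≡ ∑ (+_ ∘ f) xs
  +-∑ f []       = refl
  +-∑ f (x ∷ xs) = trans (pos-+ (f x) (ℕΣ.∑ f xs)) (cong (λ u → + f x + u) (+-∑ f xs))

  ⊛-∑ : {A : Set} (f : Series) (c : A → ℤ) (g : A → Series) (xs : List A) →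
        (f ⊛ (λ M → ∑ (λ j → c j * g j M) xs)) ≗ (λ N → ∑ (λ j → c j * (f ⊛ g j) N) xs)
  ⊛-∑ f c g []       N = trans (⊛-comm f (λ _ → + 0) N) (⊛-zeroˡ f N)
  ⊛-∑ f c g (x ∷ xs) N = begin
    (f ⊛ (λ M → c x * g x M + rest M)) N                    ≡⟨ ⊛-comm f (λ M → c x * g x M + rest M) N ⟩
    ((λ M → c x * g x M + rest M) ⊛ f) N                    ≡⟨ ⊛-distribʳ (λ M → c x * g x M) rest f N ⟩
    ((λ M → c x * g x M) ⊛ f) N + (rest ⊛ f) N              ≡⟨ cong₂ _+_ (trans (⊛-*ˡ (c x) (g x) f N) (cong (c x *_) (⊛-comm (g x) f N)))
                                                                         (trans (⊛-comm rest f N) (⊛-∑ f c g xs N)) ⟩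
    c x * (f ⊛ g x) N + ∑ (λ j → c j * (f ⊛ g j) N) xs      ∎
    where
    open ≡-Reasoning
    rest : Series
    rest M = ∑ (λ j → c j * g j M) xs

  gfTermFrom⊛-local : ∀ m k f g N → (∀ M → M ℕ.+ k ≤ N → f M ≡ g M) → (gfTermFrom m k ⊛ f) N ≡ (gfTermFrom m k ⊛ g) N
  gfTermFrom⊛-local m k f g N f≡g = ∑-cong-∈ (upTo (suc N)) (λ a∈ → agree (s≤s⁻¹ (∈-upTo⁻ a∈)))
    where
    agree : ∀ {a} → a ≤ N → gfTermFrom m k a * f (N ∸ a) ≡ gfTermFrom m k a * g (N ∸ a)
    agree {a} a≤N with a <? k
    ... | yes a<k = trans (cong (_* f (N ∸ a)) (gfTermFrom-below m k a<k)) (sym (cong (_* g (N ∸ a)) (gfTermFrom-below m k a<k)))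
    ... | no a≮k  = cong (gfTermFrom m k a *_) (f≡g (N ∸ a) (ℕ.≤-trans (ℕ.+-monoʳ-≤ (N ∸ a) (ℕ.≮⇒≥ a≮k)) (ℕ.≤-reflexive (ℕ.m∸n+n≡m a≤N))))

  catalanSeries : ℕ → Series
  catalanSeries m N = ∑ (λ n → + catalanSum n m * gfTermFrom m n N) (upTo (suc N))

  catalanTail : ℕ → Series
  catalanTail m N = ∑ (λ n → + catalanSum (suc n) m * gfTermFrom m (suc n) N) (upTo N)

  catalanSeries-head : ∀ m N → catalanSeries m N ≡ one N + catalanTail m N
  catalanSeries-head m N = trans (∑-upTo-suc (λ n → + catalanSum n m * gfTermFrom m n N) N)
    (cong (_+ catalanTail m N) (trans (*-identityˡ _) (gfTermFrom-zero m N)))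

  lastReturnTerm : (m N t j : ℕ) → ℤ
  lastReturnTerm m N t j = + primeSum (suc t) m * (+ catalanSum j (m ℕ.+ suc t) * (gfTermFrom m (suc t) ⊛ gfTermFrom (m ℕ.+ suc t) j) N)

  catalanTerm-suc : ∀ m n N → + catalanSum (suc n) m * gfTermFrom m (suc n) N ≡ ∑ (λ t → lastReturnTerm m N t (n ∸ t)) (upTo (suc n))
  catalanTerm-suc m n N = begin
    + catalanSum (suc n) m * gfTermFrom m (suc n) N
      ≡⟨ cong (λ k → + k * gfTermFrom m (suc n) N) (catalanSum-suc n m) ⟩
    + ℕΣ.∑ (λ t → F t ℕ.* P t) (upTo (suc n)) * gfTermFrom m (suc n) N
      ≡⟨ cong (_* gfTermFrom m (suc n) N) (+-∑ (λ t → F t ℕ.* P t) (upTo (suc n))) ⟩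
    ∑ (λ t → + (F t ℕ.* P t)) (upTo (suc n)) * gfTermFrom m (suc n) N
      ≡⟨ sym (∑-*ʳ (gfTermFrom m (suc n) N) (λ t → + (F t ℕ.* P t)) (upTo (suc n))) ⟩
    ∑ (λ t → + (F t ℕ.* P t) * gfTermFrom m (suc n) N) (upTo (suc n))
      ≡⟨ ∑-cong-∈ (upTo (suc n)) (λ t∈ → split (s≤s⁻¹ (∈-upTo⁻ t∈))) ⟩
    ∑ (λ t → lastReturnTerm m N t (n ∸ t)) (upTo (suc n))
      ∎
    where
    open ≡-Reasoning
    F P : ℕ → ℕ
    F t = catalanSum (n ∸ t) (m ℕ.+ suc t)
    P t = primeSum (suc t) m
    split : ∀ {t} → t ≤ n → + (F t ℕ.* P t) * gfTermFrom m (suc n) N ≡ lastReturnTerm m N t (n ∸ t)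
    split {t} t≤n = begin
      + (F t ℕ.* P t) * gfTermFrom m (suc n) N
        ≡⟨ cong₂ _*_ (pos-* (F t) (P t)) (cong (λ k → gfTermFrom m (suc k) N) (sym (ℕ.m+[n∸m]≡n t≤n))) ⟩
      + F t * + P t * gfTermFrom m (suc t ℕ.+ (n ∸ t)) N
        ≡⟨ cong (+ F t * + P t *_) (gfTermFrom-+ m (suc t) (n ∸ t) N) ⟩
      + F t * + P t * (gfTermFrom m (suc t) ⊛ gfTermFrom (m ℕ.+ suc t) (n ∸ t)) N
        ≡⟨ rotate (+ F t) (+ P t) _ ⟩
      lastReturnTerm m N t (n ∸ t)
        ∎
      where
      rotate : ∀ a b c → a * b * c ≡ b * (a * c)
      rotate = solve-∀

  lastReturnTerms-collapse : ∀ m N t → t ≤ N →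
    (∀ M → M ≤ N ∸ t → catalanSeries (m ℕ.+ suc t) M ≡ (onePlus (m ℕ.+ suc t) ⊛ ones) M) →
    ∑ (lastReturnTerm m (suc N) t) (upTo (suc N ∸ t)) ≡ + primeSum (suc t) m * gfTermFrom m t N
  lastReturnTerms-collapse m N t t≤N catalanSeries≡ = begin
    ∑ (lastReturnTerm m (suc N) t) (upTo (suc N ∸ t))
      ≡⟨ cong (λ k → ∑ (lastReturnTerm m (suc N) t) (upTo k)) (ℕ.+-∸-assoc 1 t≤N) ⟩
    ∑ (lastReturnTerm m (suc N) t) (upTo (suc (N ∸ t)))
      ≡⟨ ∑-*ˡ (+ P) (λ j → + catalanSum j m′ * (E ⊛ gfTermFrom m′ j) (suc N)) (upTo (suc (N ∸ t))) ⟩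
    + P * ∑ (λ j → + catalanSum j m′ * (E ⊛ gfTermFrom m′ j) (suc N)) (upTo (suc (N ∸ t)))
      ≡⟨ cong (+ P *_) (sym (⊛-∑ E (λ j → + catalanSum j m′) (gfTermFrom m′) (upTo (suc (N ∸ t))) (suc N))) ⟩
    + P * (E ⊛ partial) (suc N)
      ≡⟨ cong (+ P *_) (gfTermFrom⊛-local m (suc t) partial (onePlus m′ ⊛ ones) (suc N) agree) ⟩
    + P * (E ⊛ (onePlus m′ ⊛ ones)) (suc N)
      ≡⟨ cong (+ P *_) (trans (gfTermFrom-suc⊛ m t (suc N)) (X⊛-suc (gfTermFrom m t) N)) ⟩
    + P * gfTermFrom m t N
      ∎
    where
    open ≡-Reasoning
    m′ P : ℕ
    m′ = m ℕ.+ suc t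
    P  = primeSum (suc t) m
    E : Series
    E = gfTermFrom m (suc t)
    partial : Series
    partial M = ∑ (λ j → + catalanSum j m′ * gfTermFrom m′ j M) (upTo (suc (N ∸ t)))
    agree : ∀ M → M ℕ.+ suc t ≤ suc N → partial M ≡ (onePlus m′ ⊛ ones) M
    agree M bound = trans (∑-upTo-truncate (λ j → + catalanSum j m′ * gfTermFrom m′ j M) M≤N-t vanish) (catalanSeries≡ M M≤N-t)
      where
      M≤N-t : M ≤ N ∸ t
      M≤N-t = ℕ.≤-trans (ℕ.≤-reflexive (sym (ℕ.m+n∸n≡m M t)))
                        (ℕ.∸-monoˡ-≤ t (s≤s⁻¹ (ℕ.≤-trans (ℕ.≤-reflexive (sym (ℕ.+-suc M t))) bound)))
      vanish : ∀ {j} → M < j → + catalanSum j m′ * gfTermFrom m′ j M ≡ + 0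
      vanish {j} M<j = trans (cong (+ catalanSum j m′ *_) (gfTermFrom-below m′ j M<j)) (*-zeroʳ (+ catalanSum j m′))

  catalanSeries-suc : ∀ m N → (∀ {M} → M ≤ N → ∀ m → catalanSeries m M ≡ (onePlus m ⊛ ones) M) →
                      catalanSeries m (suc N) ≡ + suc m * one N + catalanTail m N
  catalanSeries-suc m N IH = begin
    catalanSeries m (suc N)
      ≡⟨ trans (catalanSeries-head m (suc N)) (+-identityˡ _) ⟩
    ∑ (λ n → + catalanSum (suc n) m * gfTermFrom m (suc n) (suc N)) (upTo (suc N))
      ≡⟨ ∑-cong (upTo (suc N)) (λ n → catalanTerm-suc m n (suc N)) ⟩
    ∑ (λ n → ∑ (λ t → lastReturnTerm m (suc N) t (n ∸ t)) (upTo (suc n))) (upTo (suc N))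
      ≡⟨ ∑-triangle (lastReturnTerm m (suc N)) (suc N) ⟩
    ∑ (λ t → ∑ (lastReturnTerm m (suc N) t) (upTo (suc N ∸ t))) (upTo (suc N))
      ≡⟨ ∑-cong-∈ (upTo (suc N)) (λ {t} t∈ →
           lastReturnTerms-collapse m N t (s≤s⁻¹ (∈-upTo⁻ t∈)) (λ M M≤ → IH (ℕ.≤-trans M≤ (ℕ.m∸n≤m N t)) (m ℕ.+ suc t))) ⟩
    ∑ (λ t → + primeSum (suc t) m * gfTermFrom m t N) (upTo (suc N))
      ≡⟨ ∑-upTo-suc (λ t → + primeSum (suc t) m * gfTermFrom m t N) N ⟩
    + suc m * gfTermFrom m 0 N + ∑ (λ t → + primeSum (suc (suc t)) m * gfTermFrom m (suc t) N) (upTo N)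
      ≡⟨ cong₂ _+_ (cong (+ suc m *_) (gfTermFrom-zero m N))
                   (∑-cong (upTo N) (λ t → cong (λ k → + k * gfTermFrom m (suc t) N) (primeSum-suc t m))) ⟩
    + suc m * one N + catalanTail m N
      ∎
    where open ≡-Reasoning

  onePlus⊛ones-step : ∀ m N T → one N + T ≡ (onePlus m ⊛ ones) N → + suc m * one N + T ≡ (onePlus m ⊛ ones) (suc N)
  onePlus⊛ones-step m zero    T coeff = begin
    + suc m * + 1 + T    ≡⟨ cong (λ u → u + T) (*-identityʳ (+ suc m)) ⟩
    + suc m + T          ≡⟨ cong (λ u → + suc m + u) T≡0 ⟩
    + suc m + + 0        ≡⟨ trans (+-identityʳ _) (sym (onePlus⊛ones-suc m 0)) ⟩
    (onePlus m ⊛ ones) 1 ∎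
    where
    open ≡-Reasoning
    T≡0 : T ≡ + 0
    T≡0 = trans (shift T) (cong (λ u → - + 1 + u) (trans coeff (onePlus⊛ones-zero m)))
      where
      shift : ∀ T → T ≡ - + 1 + (+ 1 + T)
      shift = solve-∀
  onePlus⊛ones-step m (suc N) T coeff = begin
    + suc m * + 0 + T                ≡⟨ cong (_+ T) (*-zeroʳ (+ suc m)) ⟩
    + 0 + T                          ≡⟨ coeff ⟩
    (onePlus m ⊛ ones) (suc N)       ≡⟨ trans (onePlus⊛ones-suc m N) (sym (onePlus⊛ones-suc m (suc N))) ⟩
    (onePlus m ⊛ ones) (suc (suc N)) ∎
    where open ≡-Reasoning

  catalanSeries≗onePlus⊛ones : ∀ N m → catalanSeries m N ≡ (onePlus m ⊛ ones) N
  catalanSeries≗onePlus⊛ones = <-rec _ step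
    where
    step : ∀ N → (∀ {M} → M < N → ∀ m → catalanSeries m M ≡ (onePlus m ⊛ ones) M) →
           ∀ m → catalanSeries m N ≡ (onePlus m ⊛ ones) N
    step zero    _  m = trans (catalanSeries-head m 0) (trans (+-identityʳ (+ 1)) (sym (onePlus⊛ones-zero m)))
    step (suc N) IH m = trans (catalanSeries-suc m N (λ M≤N → IH (s≤s M≤N)))
                              (onePlus⊛ones-step m N (catalanTail m N) (trans (sym (catalanSeries-head m N)) (IH ℕ.≤-refl m)))

  gfCoeff-catalanSum : ∀ N → gfCoeff (λ n → catalanSum n 0) N ≡ xOverOneMinusX N
  gfCoeff-catalanSum zero    = refl
  gfCoeff-catalanSum (suc N) = begin
    gfCoeff (λ n → catalanSum n 0) (suc N)
      ≡⟨ ∑-map (λ n → + catalanSum n 0 * gfTerm n (suc N)) suc (upTo (suc N)) ⟩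
    ∑ (λ n → + catalanSum (suc n) 0 * gfTerm (suc n) (suc N)) (upTo (suc N))
      ≡⟨ ∑-cong (upTo (suc N)) (λ n → cong (+ catalanSum (suc n) 0 *_) (gfTerm≗gfTermFrom (suc n) (suc N))) ⟩
    ∑ (λ n → + catalanSum (suc n) 0 * gfTermFrom 0 (suc n) (suc N)) (upTo (suc N))
      ≡⟨ trans (sym (+-identityˡ _)) (sym (catalanSeries-head 0 (suc N))) ⟩
    catalanSeries 0 (suc N)
      ≡⟨ trans (catalanSeries≗onePlus⊛ones (suc N) 0) (onePlus⊛ones-suc 0 N) ⟩
    + 1
      ∎
    where open ≡-Reasoning

module ParkingLots where

  open import Data.Nat using (ℕ; zero; suc; pred; _+_; _∸_; _≤_; _<_; z≤n; s≤s; s≤s⁻¹; _≤ᵇ_; _≤?_)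
  open import Data.Nat.Properties
  open import Data.Bool using (Bool; true; false; if_then_else_; _∧_)
  open import Data.Bool.Properties using (T-≡)
  open import Data.List using (List; []; _∷_; length; filter; replicate)
  open import Data.List.Relation.Unary.All as All using (All; []; _∷_)
  open import Data.Product using (_×_; _,_)
  open import Data.Empty using (⊥-elim)
  open import Function using (Equivalence)
  open import Relation.Nullary using (yes; no)
  open import Relation.Binary.PropositionalEquality
  open import Defs using (IsParkingFunction)

  Lot : Set
  Lot = List Bool

  -- Spots and preferences are 1-indexed, and preference 0 acts like 1, as in Defs.place.
  occupy : ℕ → Lot → Lot
  occupy x []          = []
  occupy x (true ∷ B)  = true ∷ occupy (pred x) B
  occupy x (false ∷ B) = if x ≤ᵇ 1 then true ∷ B else false ∷ occupy (pred x) B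

  occupyAll : List ℕ → Lot → Lot
  occupyAll []      B = B
  occupyAll (x ∷ v) B = occupyAll v (occupy x B)

  𝟙 : Bool → ℕ
  𝟙 b = if b then 1 else 0

  freeFrom : ℕ → Lot → ℕ
  freeFrom i []          = 0
  freeFrom i (true ∷ B)  = freeFrom (pred i) B
  freeFrom i (false ∷ B) = 𝟙 (i ≤ᵇ 1) + freeFrom (pred i) B

  leadingFree : Lot → ℕ
  leadingFree (false ∷ B) = suc (leadingFree B)
  leadingFree _           = 0

  inFirstGap : ℕ → Lot → Bool
  inFirstGap x []          = false
  inFirstGap x (true ∷ B)  = inFirstGap (pred x) B
  inFirstGap x (false ∷ B) = x ≤ᵇ suc (leadingFree B)

  allInFirstGap : Lot → List ℕ → Bool
  allInFirstGap B []      = true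
  allInFirstGap B (x ∷ v) = inFirstGap x B ∧ allInFirstGap (occupy x B) v

  countFrom : ℕ → List ℕ → ℕ
  countFrom i []      = 0
  countFrom i (x ∷ v) = 𝟙 (i ≤ᵇ x) + countFrom i v

  Hall : Lot → List ℕ → Set
  Hall B v = ∀ i → countFrom i v ≤ freeFrom i B

  emptyLot : ℕ → Lot
  emptyLot n = replicate n false

  Full : Lot → Set
  Full = All (_≡ true)

  true≢false : true ≢ false
  true≢false ()

  ≤⇒≤ᵇ≡true : ∀ {m n} → m ≤ n → (m ≤ᵇ n) ≡ true
  ≤⇒≤ᵇ≡true m≤n = Equivalence.to T-≡ (≤⇒≤ᵇ m≤n)

  ≤ᵇ≡true⇒≤ : ∀ {m n} → (m ≤ᵇ n) ≡ true → m ≤ n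
  ≤ᵇ≡true⇒≤ {m} {n} m≤ᵇn = ≤ᵇ⇒≤ m n (Equivalence.from T-≡ m≤ᵇn)

  ≤ᵇ≡false⇒> : ∀ {m n} → (m ≤ᵇ n) ≡ false → n < m
  ≤ᵇ≡false⇒> m≰ᵇn = ≰⇒> λ m≤n → true≢false (trans (sym (≤⇒≤ᵇ≡true m≤n)) m≰ᵇn)

  >⇒≤ᵇ≡false : ∀ {m n} → n < m → (m ≤ᵇ n) ≡ false
  >⇒≤ᵇ≡false {m} {n} n<m with m ≤ᵇ n in m≤ᵇn
  ... | false = refl
  ... | true  = ⊥-elim (<⇒≱ n<m (≤ᵇ≡true⇒≤ m≤ᵇn))

  freeFrom-occupy-≤ : ∀ B x i → 1 ≤ freeFrom x B → i ≤ x → suc (freeFrom i (occupy x B)) ≡ freeFrom i B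
  freeFrom-occupy-≤ []          x i () _
  freeFrom-occupy-≤ (true ∷ B)  x i free i≤x = freeFrom-occupy-≤ B (pred x) (pred i) free (pred-mono-≤ i≤x)
  freeFrom-occupy-≤ (false ∷ B) x i free i≤x with x ≤ᵇ 1 in x≤ᵇ1
  ... | true  rewrite ≤⇒≤ᵇ≡true {i} {1} (≤-trans i≤x (≤ᵇ≡true⇒≤ x≤ᵇ1)) = refl
  ... | false = trans (sym (+-suc (𝟙 (i ≤ᵇ 1)) _))
                      (cong (𝟙 (i ≤ᵇ 1) +_) (freeFrom-occupy-≤ B (pred x) (pred i) free (pred-mono-≤ i≤x)))

  freeFrom-occupy-mono : ∀ B x i → freeFrom i (occupy x B) ≤ freeFrom i B
  freeFrom-occupy-mono []          x i = z≤n
  freeFrom-occupy-mono (true ∷ B)  x i = freeFrom-occupy-mono B (pred x) (pred i)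
  freeFrom-occupy-mono (false ∷ B) x i with x ≤ᵇ 1
  ... | true  = m≤n+m _ _
  ... | false = +-monoʳ-≤ (𝟙 (i ≤ᵇ 1)) (freeFrom-occupy-mono B (pred x) (pred i))

  freeFrom-occupy-> : ∀ B x i k → 1 ≤ freeFrom x B → x < i → k ≤ freeFrom i B → suc k ≤ freeFrom x B → k ≤ freeFrom i (occupy x B)
  freeFrom-occupy-> []          x i k () _ _ _
  freeFrom-occupy-> (true ∷ B)  zero (suc zero) k free _ _ k<free-x =
    s≤s⁻¹ (subst (suc k ≤_) (sym (freeFrom-occupy-≤ B 0 0 free z≤n)) k<free-x)
  freeFrom-occupy-> (true ∷ B)  zero (suc (suc i)) k free _ k≤free-i k<free-x =
    freeFrom-occupy-> B 0 (suc i) k free (s≤s z≤n) k≤free-i k<free-x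
  freeFrom-occupy-> (true ∷ B)  (suc x) (suc i) k free (s≤s x<i) k≤free-i k<free-x =
    freeFrom-occupy-> B x i k free x<i k≤free-i k<free-x
  freeFrom-occupy-> (false ∷ B) x i k free x<i k≤free-i k<free-x with x ≤ᵇ 1 in x≤ᵇ1
  freeFrom-occupy-> (false ∷ B) zero          (suc zero)          k _ _ _ k<free-x | true = s≤s⁻¹ k<free-x
  freeFrom-occupy-> (false ∷ B) (suc x)       (suc zero)          k _ (s≤s ()) _ _ | true
  freeFrom-occupy-> (false ∷ B) x             (suc (suc i))       k _ _ k≤free-i _ | true = k≤free-i
  freeFrom-occupy-> (false ∷ B) (suc (suc x)) (suc (suc (suc i))) k free (s≤s (s≤s x<i)) k≤free-i k<free-x | false =
    freeFrom-occupy-> B (suc x) (suc (suc i)) k free (s≤s x<i) k≤free-i k<free-x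
  freeFrom-occupy-> (false ∷ B) (suc (suc x)) (suc (suc zero))    k _ (s≤s (s≤s ())) _ _ | false
  freeFrom-occupy-> (false ∷ B) (suc (suc x)) (suc zero)          k _ (s≤s ()) _ _ | false

  countFrom≤length : ∀ i v → countFrom i v ≤ length v
  countFrom≤length i []      = z≤n
  countFrom≤length i (x ∷ v) with i ≤ᵇ x
  ... | true  = s≤s (countFrom≤length i v)
  ... | false = m≤n⇒m≤1+n (countFrom≤length i v)

  countFrom-antitone : ∀ {x i} v → x ≤ i → countFrom i v ≤ countFrom x v
  countFrom-antitone         []      x≤i = z≤n
  countFrom-antitone {x} {i} (y ∷ v) x≤i with i ≤ᵇ y in i≤ᵇy | x ≤ᵇ y in x≤ᵇy
  ... | true  | true  = s≤s (countFrom-antitone v x≤i)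
  ... | true  | false = ⊥-elim (<-irrefl refl (≤-trans (≤ᵇ≡false⇒> x≤ᵇy) (≤-trans x≤i (≤ᵇ≡true⇒≤ i≤ᵇy))))
  ... | false | true  = m≤n⇒m≤1+n (countFrom-antitone v x≤i)
  ... | false | false = countFrom-antitone v x≤i

  countFrom-∷-≤ : ∀ {i x} v → i ≤ x → countFrom i (x ∷ v) ≡ suc (countFrom i v)
  countFrom-∷-≤ v i≤x rewrite ≤⇒≤ᵇ≡true i≤x = refl

  countFrom-∷-> : ∀ {i x} v → x < i → countFrom i (x ∷ v) ≡ countFrom i v
  countFrom-∷-> v x<i rewrite >⇒≤ᵇ≡false x<i = refl

  Hall-∷⁻ : ∀ B x v → Hall B (x ∷ v) → 1 ≤ freeFrom x B × Hall (occupy x B) v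
  Hall-∷⁻ B x v hall = free , hall′
    where
    free : 1 ≤ freeFrom x B
    free = ≤-trans (s≤s z≤n) (subst (_≤ freeFrom x B) (countFrom-∷-≤ v ≤-refl) (hall x))
    hall′ : Hall (occupy x B) v
    hall′ i with i ≤? x
    ... | yes i≤x = s≤s⁻¹ (subst (suc (countFrom i v) ≤_) (sym (freeFrom-occupy-≤ B x i free i≤x))
                                  (subst (_≤ freeFrom i B) (countFrom-∷-≤ v i≤x) (hall i)))
    ... | no  i≰x = freeFrom-occupy-> B x i (countFrom i v) free (≰⇒> i≰x)
                      (≤-trans (≤-reflexive (sym (countFrom-∷-> v (≰⇒> i≰x)))) (hall i))
                      (≤-trans (s≤s (countFrom-antitone v (<⇒≤ (≰⇒> i≰x))))
                               (≤-trans (≤-reflexive (sym (countFrom-∷-≤ v ≤-refl))) (hall x)))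

  Hall-∷⁺ : ∀ B x v → 1 ≤ freeFrom x B → Hall (occupy x B) v → Hall B (x ∷ v)
  Hall-∷⁺ B x v free hall i with i ≤? x
  ... | yes i≤x = subst (_≤ freeFrom i B) (sym (countFrom-∷-≤ v i≤x))
                        (subst (suc (countFrom i v) ≤_) (freeFrom-occupy-≤ B x i free i≤x) (s≤s (hall i)))
  ... | no  i≰x = subst (_≤ freeFrom i B) (sym (countFrom-∷-> v (≰⇒> i≰x))) (≤-trans (hall i) (freeFrom-occupy-mono B x i))

  leadingFree⇒free : ∀ y B → y ≤ leadingFree B → 1 ≤ y → 1 ≤ freeFrom y B
  leadingFree⇒free (suc zero)    (false ∷ B) _           _ = s≤s z≤n
  leadingFree⇒free (suc (suc y)) (false ∷ B) (s≤s y≤lf) _ = leadingFree⇒free (suc y) B y≤lf (s≤s z≤n)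

  inFirstGap⇒free : ∀ x B → inFirstGap x B ≡ true → 1 ≤ freeFrom x B
  inFirstGap⇒free x             (true ∷ B)  inGap = inFirstGap⇒free (pred x) B inGap
  inFirstGap⇒free zero          (false ∷ B) _     = s≤s z≤n
  inFirstGap⇒free (suc zero)    (false ∷ B) _     = s≤s z≤n
  inFirstGap⇒free (suc (suc x)) (false ∷ B) inGap =
    leadingFree⇒free (suc x) B (s≤s⁻¹ (≤ᵇ≡true⇒≤ {suc (suc x)} inGap)) (s≤s z≤n)

  ∧≡true⁻ : ∀ {a b} → (a ∧ b) ≡ true → a ≡ true × b ≡ true
  ∧≡true⁻ {true} {true} _ = refl , refl

  ∧≡true⁺ : ∀ {a b} → a ≡ true → b ≡ true → (a ∧ b) ≡ true
  ∧≡true⁺ refl refl = refl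

  allInFirstGap⇒Hall : ∀ B v → allInFirstGap B v ≡ true → Hall B v
  allInFirstGap⇒Hall B []      _   i = z≤n
  allInFirstGap⇒Hall B (x ∷ v) all =
    let inGap , rest = ∧≡true⁻ {inFirstGap x B} all
    in Hall-∷⁺ B x v (inFirstGap⇒free x B inGap) (allInFirstGap⇒Hall (occupy x B) v rest)

  freeFrom0≡0⇒Full : ∀ B → freeFrom 0 B ≡ 0 → Full B
  freeFrom0≡0⇒Full []          _       = []
  freeFrom0≡0⇒Full (true ∷ B)  no-free = refl ∷ freeFrom0≡0⇒Full B no-free

  Hall⇒occupyAll-Full : ∀ B v → Hall B v → length v ≡ freeFrom 0 B → Full (occupyAll v B)
  Hall⇒occupyAll-Full B []      _    #v = freeFrom0≡0⇒Full B (sym #v)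
  Hall⇒occupyAll-Full B (x ∷ v) hall #v =
    let free , hall′ = Hall-∷⁻ B x v hall
    in Hall⇒occupyAll-Full (occupy x B) v hall′ (suc-injective (trans #v (sym (freeFrom-occupy-≤ B x 0 free z≤n))))

  freeFrom-emptyLot-0 : ∀ n → freeFrom 0 (emptyLot n) ≡ n
  freeFrom-emptyLot-0 zero    = refl
  freeFrom-emptyLot-0 (suc n) = cong suc (freeFrom-emptyLot-0 n)

  freeFrom-emptyLot : ∀ n i → freeFrom (suc i) (emptyLot n) ≡ n ∸ i
  freeFrom-emptyLot zero    i       = sym (0∸n≡0 i)
  freeFrom-emptyLot (suc n) zero    = cong suc (freeFrom-emptyLot-0 n)
  freeFrom-emptyLot (suc n) (suc i) = freeFrom-emptyLot n i

  length-filter+countFrom : ∀ i f → length (filter (_≤? i) f) + countFrom (suc i) f ≡ length f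
  length-filter+countFrom i []      = refl
  length-filter+countFrom i (x ∷ f) with x ≤ᵇ i in x≤ᵇi
  ... | true  = trans (cong (suc (length (filter (_≤? i) f)) +_) (countFrom-∷-> {x = x} f (s≤s (≤ᵇ≡true⇒≤ x≤ᵇi))))
                      (cong suc (length-filter+countFrom i f))
  ... | false = trans (cong (length (filter (_≤? i) f) +_) (countFrom-∷-≤ {x = x} f (≤ᵇ≡false⇒> x≤ᵇi)))
                      (trans (+-suc _ _) (cong suc (length-filter+countFrom i f)))

  countFrom-0 : ∀ f → countFrom 0 f ≡ length f
  countFrom-0 []      = refl
  countFrom-0 (x ∷ f) = cong suc (countFrom-0 f)

  countFrom-above : ∀ i f → All (_< i) f → countFrom i f ≡ 0
  countFrom-above i []      _            = refl
  countFrom-above i (x ∷ f) (x<i ∷ f<i) = trans (countFrom-∷-> f x<i) (countFrom-above i f f<i)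

  Hall⇒IsParkingFunction : ∀ n f → length f ≡ n → Hall (emptyLot n) f → IsParkingFunction n f
  Hall⇒IsParkingFunction n f #f hall i _ i≤n = begin
    i                              ≡⟨ sym (m∸[m∸n]≡n i≤n) ⟩
    n ∸ (n ∸ i)                    ≤⟨ ∸-monoʳ-≤ n late≤ ⟩
    n ∸ late                       ≡⟨ cong (_∸ late) (sym (trans (length-filter+countFrom i f) #f)) ⟩
    early + late ∸ late            ≡⟨ m+n∸n≡m early late ⟩
    early                          ∎
    where
    open ≤-Reasoning
    early late : ℕ
    early = length (filter (_≤? i) f)
    late  = countFrom (suc i) f
    late≤ : late ≤ n ∸ i
    late≤ = subst (late ≤_) (freeFrom-emptyLot n i) (hall (suc i))

  IsParkingFunction⇒Hall : ∀ n f → length f ≡ n → All (_≤ n) f → IsParkingFunction n f → Hall (emptyLot n) f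
  IsParkingFunction⇒Hall n f #f f≤n pf zero          =
    ≤-reflexive (trans (countFrom-0 f) (trans #f (sym (freeFrom-emptyLot-0 n))))
  IsParkingFunction⇒Hall n f #f f≤n pf (suc zero)    =
    subst (countFrom 1 f ≤_) (sym (freeFrom-emptyLot n 0)) (subst (countFrom 1 f ≤_) #f (countFrom≤length 1 f))
  IsParkingFunction⇒Hall n f #f f≤n pf (suc (suc i)) with suc i ≤? n
  ... | yes i<n = subst (late ≤_) (sym (freeFrom-emptyLot n (suc i))) (begin
    late                    ≡⟨ sym (m+n∸m≡n early late) ⟩
    early + late ∸ early    ≡⟨ cong (_∸ early) (trans (length-filter+countFrom (suc i) f) #f) ⟩
    n ∸ early               ≤⟨ ∸-monoʳ-≤ n (pf (suc i) (s≤s z≤n) i<n) ⟩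
    n ∸ suc i               ∎)
    where
    open ≤-Reasoning
    early late : ℕ
    early = length (filter (_≤? suc i) f)
    late  = countFrom (suc (suc i)) f
  ... | no  i≮n = ≤-trans (≤-reflexive (countFrom-above (suc (suc i)) f (All.map (λ x≤n → s≤s (≤-trans x≤n (<⇒≤ (≰⇒> i≮n)))) f≤n))) z≤n

module FirstGapCount where

  open import Data.Bool using (true; false; _∧_)
  open import Data.Nat using (ℕ; zero; suc; pred; _+_; _*_; _∸_; _≤_; _<_; z≤n; s≤s; _≤ᵇ_)
  open import Data.Nat.Properties
  open import Data.Nat.Induction using (<-rec)
  open import Data.List using ([]; _∷_; map; length; replicate; _++_; upTo; concatMap)
  open import Data.List.Properties using (length-++; length-replicate; ++-identityʳ; length-upTo)
  open import Data.List.Membership.Propositional.Properties using (∈-upTo⁻)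
  open import Relation.Binary.PropositionalEquality
  open import Data.Nat.Tactic.RingSolver using (solve-∀)
  open import Defs using (words; fromTo)
  open Sums
  open LastReturn using (catalanSum; catalanSum-suc; primeSum; primeSum-suc)
  open ParkingLots
  open ℕΣ

  fullLot : ℕ → Lot
  fullLot a = replicate a true

  data StartsFull : Lot → Set where
    []  : StartsFull []
    _∷_ : ∀ {R} → StartsFull (true ∷ R)

  pred-∸ : ∀ x a → pred x ∸ a ≡ x ∸ suc a
  pred-∸ zero    a = 0∸n≡0 a
  pred-∸ (suc x) a = refl

  inFirstGap-fullLot : ∀ a x Q → inFirstGap x (fullLot a ++ Q) ≡ inFirstGap (x ∸ a) Q
  inFirstGap-fullLot zero    x Q = refl
  inFirstGap-fullLot (suc a) x Q = trans (inFirstGap-fullLot a (pred x) Q) (cong (λ y → inFirstGap y Q) (pred-∸ x a))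

  occupy-fullLot : ∀ a x Q → occupy x (fullLot a ++ Q) ≡ fullLot a ++ occupy (x ∸ a) Q
  occupy-fullLot zero    x Q = refl
  occupy-fullLot (suc a) x Q = cong (true ∷_) (trans (occupy-fullLot a (pred x) Q) (cong (λ y → fullLot a ++ occupy y Q) (pred-∸ x a)))

  leadingFree-emptyLot : ∀ l {R} → StartsFull R → leadingFree (emptyLot l ++ R) ≡ l
  leadingFree-emptyLot zero    []  = refl
  leadingFree-emptyLot zero    _∷_ = refl
  leadingFree-emptyLot (suc l) sR  = cong suc (leadingFree-emptyLot l sR)

  fullLot-∷ʳ : ∀ a Q → fullLot a ++ true ∷ Q ≡ fullLot (suc a) ++ Q
  fullLot-∷ʳ zero    Q = refl
  fullLot-∷ʳ (suc a) Q = cong (true ∷_) (fullLot-∷ʳ a Q)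

  length-emptyLot-++ : ∀ k Q → length (emptyLot k ++ Q) ≡ k + length Q
  length-emptyLot-++ k Q = trans (length-++ (emptyLot k)) (cong (_+ length Q) (length-replicate k))

  occupy-inside-gap : ∀ j l R → suc j ≤ l → occupy (suc (suc j)) (false ∷ emptyLot l ++ R) ≡ emptyLot (suc j) ++ true ∷ emptyLot (l ∸ suc j) ++ R
  occupy-inside-gap zero    (suc l) R _         = refl
  occupy-inside-gap (suc j) (suc l) R (s≤s j<l) = cong (false ∷_) (occupy-inside-gap j l R j<l)

  𝟙-∧ : ∀ a b → 𝟙 (a ∧ b) ≡ 𝟙 a * 𝟙 b
  𝟙-∧ true  b = sym (+-identityʳ (𝟙 b))
  𝟙-∧ false b = refl

  goodCount : ℕ → Lot → ℕ → ℕ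
  goodCount N B r = ∑ (λ v → 𝟙 (allInFirstGap B v)) (words r N)

  goodCount-suc : ∀ N B r → goodCount N B (suc r) ≡ ∑ (λ x → 𝟙 (inFirstGap x B) * goodCount N (occupy x B) r) (fromTo 1 N)
  goodCount-suc N B r = begin
    ∑ (λ v → 𝟙 (allInFirstGap B v)) (concatMap (λ v → map (_∷ v) (fromTo 1 N)) (words r N))
      ≡⟨ ∑-concatMap _ (λ v → map (_∷ v) (fromTo 1 N)) (words r N) ⟩
    ∑ (λ v → ∑ (λ f → 𝟙 (allInFirstGap B f)) (map (_∷ v) (fromTo 1 N))) (words r N)
      ≡⟨ ∑-cong (words r N) (λ v → trans (∑-map _ (_∷ v) (fromTo 1 N))
                                         (∑-cong (fromTo 1 N) (λ x → 𝟙-∧ (inFirstGap x B) (allInFirstGap (occupy x B) v)))) ⟩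
    ∑ (λ v → ∑ (λ x → 𝟙 (inFirstGap x B) * 𝟙 (allInFirstGap (occupy x B) v)) (fromTo 1 N)) (words r N)
      ≡⟨ ∑-comm (λ v x → 𝟙 (inFirstGap x B) * 𝟙 (allInFirstGap (occupy x B) v)) (words r N) (fromTo 1 N) ⟩
    ∑ (λ x → ∑ (λ v → 𝟙 (inFirstGap x B) * 𝟙 (allInFirstGap (occupy x B) v)) (words r N)) (fromTo 1 N)
      ≡⟨ ∑-cong (fromTo 1 N) (λ x → ∑-*ˡ (𝟙 (inFirstGap x B)) _ (words r N)) ⟩
    ∑ (λ x → 𝟙 (inFirstGap x B) * goodCount N (occupy x B) r) (fromTo 1 N)
      ∎
    where open ≡-Reasoning

  module _ (N : ℕ) where

    BlockFactorises : ℕ → Set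
    BlockFactorises l = ∀ a R r → StartsFull R → a + l + length R ≡ N →
      goodCount N (fullLot a ++ emptyLot l ++ R) (l + r) ≡ catalanSum l a * goodCount N (fullLot (a + l) ++ R) r

    module BlockStep (l : ℕ) (IH : ∀ {k} → k < suc l → BlockFactorises k)
                     (a : ℕ) {R : Lot} (r : ℕ) (sR : StartsFull R) (#lot : a + suc l + length R ≡ N) where

      open ≡-Reasoning

      lot : Lot
      lot = fullLot a ++ emptyLot (suc l) ++ R

      restCount : ℕ
      restCount = goodCount N (fullLot (a + suc l) ++ R) r

      choiceCount : ℕ → ℕ
      choiceCount x = 𝟙 (inFirstGap (suc x) lot) * goodCount N (occupy (suc x) lot) (l + r)

      splitCount : ℕ → ℕ
      splitCount j = catalanSum (suc j) a * (catalanSum (l ∸ suc j) (suc (a + suc j)) * restCount)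

      inFirstGap-lot : ∀ x → inFirstGap (suc x) lot ≡ ((suc x ∸ a) ≤ᵇ suc l)
      inFirstGap-lot x = trans (inFirstGap-fullLot a (suc x) (emptyLot (suc l) ++ R))
                               (cong (λ k → (suc x ∸ a) ≤ᵇ suc k) (leadingFree-emptyLot l sR))

      occupy-lot : ∀ x → occupy (suc x) lot ≡ fullLot a ++ occupy (suc x ∸ a) (false ∷ emptyLot l ++ R)
      occupy-lot x = occupy-fullLot a (suc x) (emptyLot (suc l) ++ R)

      choiceCount-first-spot : ∀ {x} → x < suc a → choiceCount x ≡ catalanSum l (suc a) * restCount
      choiceCount-first-spot {x} x<1+a = begin
        choiceCount x
          ≡⟨ cong₂ (λ u w → 𝟙 u * goodCount N w (l + r))
                   (trans (inFirstGap-lot x) (≤⇒≤ᵇ≡true (≤-trans y≤1 (s≤s z≤n))))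
                   (trans (occupy-lot x) (trans (cong (fullLot a ++_) occupy-y) (fullLot-∷ʳ a (emptyLot l ++ R)))) ⟩
        1 * goodCount N (fullLot (suc a) ++ emptyLot l ++ R) (l + r)
          ≡⟨ trans (+-identityʳ _) (IH ≤-refl (suc a) R r sR (trans (cong (_+ length R) (sym (+-suc a l))) #lot)) ⟩
        catalanSum l (suc a) * goodCount N (fullLot (suc a + l) ++ R) r
          ≡⟨ cong (λ k → catalanSum l (suc a) * goodCount N (fullLot k ++ R) r) (sym (+-suc a l)) ⟩
        catalanSum l (suc a) * restCount
          ∎
        where
        y≤1 : suc x ∸ a ≤ 1
        y≤1 = ≤-trans (∸-monoˡ-≤ a x<1+a) (≤-reflexive (trans (cong (_∸ a) (+-comm 1 a)) (m+n∸m≡n a 1)))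
        occupy-y : occupy (suc x ∸ a) (false ∷ emptyLot l ++ R) ≡ true ∷ emptyLot l ++ R
        occupy-y rewrite ≤⇒≤ᵇ≡true y≤1 = refl

      choiceCount-inside-gap : ∀ {j} → j < l → choiceCount (suc a + j) ≡ splitCount j
      choiceCount-inside-gap {j} j<l = begin
        choiceCount (suc a + j)
          ≡⟨ cong₂ (λ u w → 𝟙 u * goodCount N w (l + r))
                   (trans (inFirstGap-lot (suc a + j)) (trans (cong (_≤ᵇ suc l) y≡) (≤⇒≤ᵇ≡true (s≤s j<l))))
                   (trans (occupy-lot (suc a + j)) (cong (λ y → fullLot a ++ occupy y (false ∷ emptyLot l ++ R)) y≡)) ⟩
        1 * goodCount N (fullLot a ++ occupy (suc (suc j)) (false ∷ emptyLot l ++ R)) (l + r)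
          ≡⟨ trans (+-identityʳ _) (cong₂ (λ w k → goodCount N (fullLot a ++ w) k) (occupy-inside-gap j l R j<l) l+r≡) ⟩
        goodCount N (fullLot a ++ emptyLot (suc j) ++ R′) (suc j + (l ∸ suc j + r))
          ≡⟨ IH (s≤s j<l) a R′ (l ∸ suc j + r) _∷_ #left ⟩
        catalanSum (suc j) a * goodCount N (fullLot (a + suc j) ++ R′) (l ∸ suc j + r)
          ≡⟨ cong (λ w → catalanSum (suc j) a * goodCount N w (l ∸ suc j + r)) (fullLot-∷ʳ (a + suc j) (emptyLot (l ∸ suc j) ++ R)) ⟩
        catalanSum (suc j) a * goodCount N (fullLot (suc (a + suc j)) ++ emptyLot (l ∸ suc j) ++ R) (l ∸ suc j + r)
          ≡⟨ cong (catalanSum (suc j) a *_) (IH (s≤s (m∸n≤m l (suc j))) (suc (a + suc j)) R r sR (trans (cong (_+ length R) a′≡) #lot)) ⟩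
        catalanSum (suc j) a * (catalanSum (l ∸ suc j) (suc (a + suc j)) * goodCount N (fullLot (suc (a + suc j) + (l ∸ suc j)) ++ R) r)
          ≡⟨ cong (λ k → catalanSum (suc j) a * (catalanSum (l ∸ suc j) (suc (a + suc j)) * goodCount N (fullLot k ++ R) r)) a′≡ ⟩
        splitCount j
          ∎
        where
        R′ : Lot
        R′ = true ∷ emptyLot (l ∸ suc j) ++ R
        split-l : suc j + (l ∸ suc j) ≡ l
        split-l = m+[n∸m]≡n j<l
        y≡ : suc (suc a + j) ∸ a ≡ suc (suc j)
        y≡ = trans (cong (_∸ a) (shuffle a j)) (m+n∸m≡n a (suc (suc j)))
          where
          shuffle : ∀ a j → suc (suc a + j) ≡ a + suc (suc j)
          shuffle = solve-∀
        l+r≡ : l + r ≡ suc j + (l ∸ suc j + r)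
        l+r≡ = trans (cong (_+ r) (sym split-l)) (+-assoc (suc j) (l ∸ suc j) r)
        a′≡ : suc (a + suc j) + (l ∸ suc j) ≡ a + suc l
        a′≡ = trans (shuffle a (suc j) (l ∸ suc j)) (cong (λ k → a + suc k) split-l)
          where
          shuffle : ∀ a s t → suc (a + s) + t ≡ a + suc (s + t)
          shuffle = solve-∀
        #left : a + suc j + length R′ ≡ N
        #left = trans (cong (λ k → a + suc j + suc k) (length-emptyLot-++ (l ∸ suc j) R))
                      (trans (shuffle a (suc j) (l ∸ suc j) (length R)) (trans (cong (λ k → a + suc k + length R) split-l) #lot))
          where
          shuffle : ∀ a s t k → a + s + suc (t + k) ≡ a + suc (s + t) + k
          shuffle = solve-∀

      choiceCount-beyond-gap : ∀ t → choiceCount (suc a + (l + t)) ≡ 0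
      choiceCount-beyond-gap t = cong (λ u → 𝟙 u * goodCount N (occupy (suc (suc a + (l + t))) lot) (l + r))
        (trans (inFirstGap-lot (suc a + (l + t))) (>⇒≤ᵇ≡false (≤-trans (s≤s (s≤s (m≤m+n l t))) (≤-reflexive (sym y≡)))))
        where
        y≡ : suc (suc a + (l + t)) ∸ a ≡ suc (suc (l + t))
        y≡ = trans (cong (_∸ a) (shuffle a (l + t))) (m+n∸m≡n a (suc (suc (l + t))))
          where
          shuffle : ∀ a j → suc (suc a + j) ≡ a + suc (suc j)
          shuffle = solve-∀

      catalanSum-suc-restCount : catalanSum (suc l) a * restCount ≡ suc a * (catalanSum l (suc a) * restCount) + ∑ splitCount (upTo l)
      catalanSum-suc-restCount = begin
        catalanSum (suc l) a * restCount
          ≡⟨ cong (_* restCount) (catalanSum-suc l a) ⟩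
        ∑ (λ t → catalanSum (l ∸ t) (a + suc t) * primeSum (suc t) a) (upTo (suc l)) * restCount
          ≡⟨ sym (∑-*ʳ restCount (λ t → catalanSum (l ∸ t) (a + suc t) * primeSum (suc t) a) (upTo (suc l))) ⟩
        ∑ (λ t → catalanSum (l ∸ t) (a + suc t) * primeSum (suc t) a * restCount) (upTo (suc l))
          ≡⟨ ∑-upTo-suc (λ t → catalanSum (l ∸ t) (a + suc t) * primeSum (suc t) a * restCount) l ⟩
        catalanSum l (a + 1) * suc a * restCount
          + ∑ (λ t → catalanSum (l ∸ suc t) (a + suc (suc t)) * primeSum (suc (suc t)) a * restCount) (upTo l)
          ≡⟨ cong₂ _+_ (trans (cong (λ k → catalanSum l k * suc a * restCount) (+-comm a 1)) (rotate (catalanSum l (suc a)) (suc a) restCount))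
                       (∑-cong (upTo l) (λ t → trans (cong₂ (λ k p → catalanSum (l ∸ suc t) k * p * restCount) (+-suc a (suc t)) (primeSum-suc t a))
                                                     (rotate (catalanSum (l ∸ suc t) (suc (a + suc t))) (catalanSum (suc t) a) restCount))) ⟩
        suc a * (catalanSum l (suc a) * restCount) + ∑ splitCount (upTo l)
          ∎
        where
        rotate : ∀ x y z → x * y * z ≡ y * (x * z)
        rotate = solve-∀

      goodCount-lot : goodCount N lot (suc (l + r)) ≡ catalanSum (suc l) a * restCount
      goodCount-lot = begin
        goodCount N lot (suc (l + r))
          ≡⟨ goodCount-suc N lot (l + r) ⟩
        ∑ (λ x → 𝟙 (inFirstGap x lot) * goodCount N (occupy x lot) (l + r)) (fromTo 1 N)
          ≡⟨ trans (∑-map _ suc (upTo N)) (cong (λ n → ∑ choiceCount (upTo n)) N≡) ⟩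
        ∑ choiceCount (upTo (suc a + (l + length R)))
          ≡⟨ ∑-upTo-+ choiceCount (suc a) (l + length R) ⟩
        ∑ choiceCount (upTo (suc a)) + ∑ (λ j → choiceCount (suc a + j)) (upTo (l + length R))
          ≡⟨ cong (∑ choiceCount (upTo (suc a)) +_) (∑-upTo-+ (λ j → choiceCount (suc a + j)) l (length R)) ⟩
        ∑ choiceCount (upTo (suc a)) + (∑ (λ j → choiceCount (suc a + j)) (upTo l) + ∑ (λ t → choiceCount (suc a + (l + t))) (upTo (length R)))
          ≡⟨ cong₂ (λ u v → u + (v + ∑ (λ t → choiceCount (suc a + (l + t))) (upTo (length R)))) first-spot inside-gap ⟩
        suc a * (catalanSum l (suc a) * restCount) + (∑ splitCount (upTo l) + ∑ (λ t → choiceCount (suc a + (l + t))) (upTo (length R)))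
          ≡⟨ cong (λ u → suc a * (catalanSum l (suc a) * restCount) + u) (trans (cong (∑ splitCount (upTo l) +_) beyond-gap) (+-identityʳ _)) ⟩
        suc a * (catalanSum l (suc a) * restCount) + ∑ splitCount (upTo l)
          ≡⟨ sym catalanSum-suc-restCount ⟩
        catalanSum (suc l) a * restCount
          ∎
        where
        N≡ : N ≡ suc a + (l + length R)
        N≡ = trans (sym #lot) (shuffle a l (length R))
          where
          shuffle : ∀ a l k → a + suc l + k ≡ suc a + (l + k)
          shuffle = solve-∀
        first-spot : ∑ choiceCount (upTo (suc a)) ≡ suc a * (catalanSum l (suc a) * restCount)
        first-spot = trans (∑-cong-∈ (upTo (suc a)) (λ x∈ → choiceCount-first-spot (∈-upTo⁻ x∈)))
                           (trans (∑-const _ (upTo (suc a))) (cong (_* (catalanSum l (suc a) * restCount)) (length-upTo (suc a))))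
        inside-gap : ∑ (λ j → choiceCount (suc a + j)) (upTo l) ≡ ∑ splitCount (upTo l)
        inside-gap = ∑-cong-∈ (upTo l) (λ j∈ → choiceCount-inside-gap (∈-upTo⁻ j∈))
        beyond-gap : ∑ (λ t → choiceCount (suc a + (l + t))) (upTo (length R)) ≡ 0
        beyond-gap = trans (∑-cong (upTo (length R)) choiceCount-beyond-gap) (∑-zero (upTo (length R)))

    blockFactorises : ∀ l → BlockFactorises l
    blockFactorises = <-rec BlockFactorises step
      where
      step : ∀ l → (∀ {k} → k < l → BlockFactorises k) → BlockFactorises l
      step zero    _  a R r _  _    = trans (cong (λ k → goodCount N (fullLot k ++ R) r) (sym (+-identityʳ a))) (sym (+-identityʳ _))
      step (suc l) IH a R r sR #lot = BlockStep.goodCount-lot l IH a r sR #lot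

  goodCount-emptyLot : ∀ n → goodCount n (emptyLot n) n ≡ catalanSum n 0
  goodCount-emptyLot n = begin
    goodCount n (emptyLot n) n                               ≡⟨ cong₂ (goodCount n) (sym (++-identityʳ (emptyLot n))) (sym (+-identityʳ n)) ⟩
    goodCount n (emptyLot n ++ []) (n + 0)                   ≡⟨ blockFactorises n n 0 [] 0 [] (+-identityʳ n) ⟩
    catalanSum n 0 * 1                                       ≡⟨ *-identityʳ (catalanSum n 0) ⟩
    catalanSum n 0                                           ∎
    where open ≡-Reasoning

module Placement where

  open import Data.Nat using (ℕ; zero; suc; pred; _≤_; _<_; s≤s; s≤s⁻¹; _≤ᵇ_)
  open import Data.Nat.Properties using (≤-refl; ≤-trans; n≤1+n; m≤n⇒m≤1+n; <-asym)
  open import Data.Bool using (true; false)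
  open import Data.Maybe using (Maybe; just; nothing; is-just)
  import Data.Maybe.Relation.Unary.All as Maybe
  open import Data.List using (List; []; _∷_; map; _++_)
  open import Data.List.Relation.Unary.All using (All; []; _∷_)
  open import Data.List.Relation.Unary.All.Properties using (++⁻ˡ; ++⁻ʳ)
  open import Data.List.Relation.Unary.Any using (here; there)
  open import Data.List.Membership.Propositional using (_∈_)
  open import Data.List.Relation.Binary.Pointwise using (Pointwise; []; _∷_)
  import Data.List.Relation.Binary.Pointwise.Properties as Pointwise
  open import Data.List.Relation.Binary.Sublist.Propositional using (_⊆_; []; _∷_; _∷ʳ_; from∈)
  open import Data.List.Relation.Binary.Sublist.Propositional.Properties using (++⁺; All-resp-⊆)
  open import Data.Product using (Σ-syntax; _×_; _,_)
  open import Data.Sum using (_⊎_; inj₁; inj₂)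
  open import Data.Empty using (⊥)
  open import Relation.Nullary using (¬_)
  open import Relation.Binary.PropositionalEquality
  open import Defs using (place; parkFrom)
  open ParkingLots

  Spots : Set
  Spots = List (Maybe ℕ)

  occupancy : Spots → Lot
  occupancy = map is-just

  place-1 : ∀ c O → place c 1 O ≡ place c 0 O
  place-1 c []            = refl
  place-1 c (nothing ∷ O) = refl
  place-1 c (just d ∷ O)  = cong (just d ∷_) (place-1 c O)

  place-just : ∀ c x d O → place c x (just d ∷ O) ≡ just d ∷ place c (pred x) O
  place-just c zero          d O = refl
  place-just c (suc zero)    d O = cong (just d ∷_) (place-1 c O)
  place-just c (suc (suc x)) d O = refl

  occupancy-place : ∀ c x O → occupancy (place c x O) ≡ occupy x (occupancy O)
  occupancy-place c x             []            = refl
  occupancy-place c zero          (nothing ∷ O) = refl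
  occupancy-place c (suc zero)    (nothing ∷ O) = refl
  occupancy-place c (suc (suc x)) (nothing ∷ O) = cong (false ∷_) (occupancy-place c (suc x) O)
  occupancy-place c x             (just d ∷ O)  = trans (cong occupancy (place-just c x d O)) (cong (true ∷_) (occupancy-place c (pred x) O))

  occupancy-parkFrom : ∀ c v O → occupancy (parkFrom c v O) ≡ occupyAll v (occupancy O)
  occupancy-parkFrom c []      O = refl
  occupancy-parkFrom c (x ∷ v) O = trans (occupancy-parkFrom (suc c) v (place c x O)) (cong (occupyAll v) (occupancy-place c x O))

  data FilledThenEmpty : Spots → Set where
    empty  : ∀ {X : Spots} → All (_≡ nothing) X → FilledThenEmpty X
    filled : ∀ {d X} → FilledThenEmpty X → FilledThenEmpty (just d ∷ X)

  no-car-in-empty : ∀ {X : Spots} {b : ℕ} → All (_≡ nothing) X → ¬ (just b ∷ [] ⊆ X)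
  no-car-in-empty (() ∷ _)         (refl ∷ _)
  no-car-in-empty (_  ∷ X-empty)   (_ ∷ʳ sub) = no-car-in-empty X-empty sub

  FilledThenEmpty-no-gap : ∀ {X : Spots} {b : ℕ} → FilledThenEmpty X → ¬ (nothing ∷ just b ∷ [] ⊆ X)
  FilledThenEmpty-no-gap (empty (_ ∷ X-empty)) (refl ∷ sub) = no-car-in-empty X-empty sub
  FilledThenEmpty-no-gap (empty (_ ∷ X-empty)) (_ ∷ʳ sub)   = FilledThenEmpty-no-gap (empty X-empty) sub
  FilledThenEmpty-no-gap (filled X)            (() ∷ _)
  FilledThenEmpty-no-gap (filled X)            (_ ∷ʳ sub)   = FilledThenEmpty-no-gap X sub

  ParksInFirstGap : ℕ → ℕ → Spots → Set
  ParksInFirstGap c x O = Σ[ X ∈ Spots ] Σ[ Y ∈ Spots ]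
    (O ≡ X ++ nothing ∷ Y × place c x O ≡ X ++ just c ∷ Y × FilledThenEmpty X)

  private
    parks-in-leading-gap : ∀ c y O → (y ≤ᵇ suc (leadingFree (occupancy O))) ≡ true →
      Σ[ X ∈ Spots ] Σ[ Y ∈ Spots ] (nothing ∷ O ≡ X ++ nothing ∷ Y × place c y (nothing ∷ O) ≡ X ++ just c ∷ Y × All (_≡ nothing) X)
    parks-in-leading-gap c zero          O             _ = [] , O , refl , refl , []
    parks-in-leading-gap c (suc zero)    O             _ = [] , O , refl , refl , []
    parks-in-leading-gap c (suc (suc y)) (nothing ∷ O) inGap with parks-in-leading-gap c (suc y) O inGap
    ... | X , Y , O≡ , placed , X-empty = nothing ∷ X , Y , cong (nothing ∷_) O≡ , cong (nothing ∷_) placed , refl ∷ X-empty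
    parks-in-leading-gap c (suc (suc zero))    (just d ∷ O) ()
    parks-in-leading-gap c (suc (suc (suc y))) (just d ∷ O) ()
    parks-in-leading-gap c (suc (suc zero))    []           ()
    parks-in-leading-gap c (suc (suc (suc y))) []           ()

  inFirstGap⇒ParksInFirstGap : ∀ c x O → inFirstGap x (occupancy O) ≡ true → ParksInFirstGap c x O
  inFirstGap⇒ParksInFirstGap c x (just d ∷ O) inGap with inFirstGap⇒ParksInFirstGap c (pred x) O inGap
  ... | X , Y , O≡ , placed , X-ok = just d ∷ X , Y , cong (just d ∷_) O≡ , trans (place-just c x d O) (cong (just d ∷_) placed) , filled X-ok
  inFirstGap⇒ParksInFirstGap c x (nothing ∷ O) inGap with parks-in-leading-gap c x O inGap
  ... | X , Y , O≡ , placed , X-empty = X , Y , O≡ , placed , empty X-empty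

  ∈-place : ∀ c y Q → 1 ≤ freeFrom y (occupancy Q) → just c ∈ place c y Q
  ∈-place c zero          (nothing ∷ Q) _    = here refl
  ∈-place c (suc zero)    (nothing ∷ Q) _    = here refl
  ∈-place c (suc (suc y)) (nothing ∷ Q) free = there (∈-place c (suc y) Q free)
  ∈-place c y             (just d ∷ Q)  free = subst (just c ∈_) (sym (place-just c y d Q)) (there (∈-place c (pred y) Q free))

  private
    parks-beyond-leading-gap : ∀ c y O → leadingFree (occupancy O) < y → 1 ≤ freeFrom y (occupancy O) →
      Σ[ t ∈ ℕ ] (just t ∈ O × just t ∷ just c ∷ [] ⊆ place c y O)
    parks-beyond-leading-gap c (suc (suc y)) (nothing ∷ O) (s≤s lf<y) free with parks-beyond-leading-gap c (suc y) O lf<y free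
    ... | t , t∈ , sub = t , there t∈ , nothing ∷ʳ sub
    parks-beyond-leading-gap c (suc zero) (nothing ∷ O) (s≤s ()) _
    parks-beyond-leading-gap c y (just d ∷ O) _ free =
      d , here refl , subst (just d ∷ just c ∷ [] ⊆_) (sym (place-just c y d O)) (refl ∷ from∈ (∈-place c (pred y) O free))

  ¬inFirstGap⇒gap-before : ∀ c x O → inFirstGap x (occupancy O) ≡ false → 1 ≤ freeFrom x (occupancy O) →
    Σ[ t ∈ ℕ ] (just t ∈ O × nothing ∷ just t ∷ just c ∷ [] ⊆ place c x O)
  ¬inFirstGap⇒gap-before c x (just d ∷ O) outside free with ¬inFirstGap⇒gap-before c (pred x) O outside free
  ... | t , t∈ , sub = t , there t∈ , subst (nothing ∷ just t ∷ just c ∷ [] ⊆_) (sym (place-just c x d O)) (just d ∷ʳ sub)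
  ¬inFirstGap⇒gap-before c (suc (suc x)) (nothing ∷ O) outside free
    with parks-beyond-leading-gap c (suc x) O (s≤s⁻¹ (≤ᵇ≡false⇒> {suc (suc x)} outside)) free
  ... | t , t∈ , sub = t , there t∈ , refl ∷ sub

  data FillsLater (c : ℕ) : Maybe ℕ → Maybe ℕ → Set where
    kept   : ∀ {o} → FillsLater c o o
    filled : ∀ {e} → c ≤ e → FillsLater c nothing (just e)

  FillsLater-trans : ∀ {c o₁ o₂ o₃} → FillsLater c o₁ o₂ → FillsLater c o₂ o₃ → FillsLater c o₁ o₃
  FillsLater-trans kept       r    = r
  FillsLater-trans (filled c≤e) kept = filled c≤e

  Refines : ℕ → Spots → Spots → Set
  Refines c = Pointwise (FillsLater c)

  place-refines : ∀ {c d} x O → c ≤ d → Refines c O (place d x O)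
  place-refines             x             []            c≤d = []
  place-refines             zero          (nothing ∷ O) c≤d = filled c≤d ∷ Pointwise.refl kept
  place-refines             (suc zero)    (nothing ∷ O) c≤d = filled c≤d ∷ Pointwise.refl kept
  place-refines             (suc (suc x)) (nothing ∷ O) c≤d = kept ∷ place-refines (suc x) O c≤d
  place-refines {c} {d}     x             (just a ∷ O)  c≤d =
    subst (Refines c (just a ∷ O)) (sym (place-just d x a O)) (kept ∷ place-refines (pred x) O c≤d)

  parkFrom-refines : ∀ {c} d v O → c ≤ d → Refines c O (parkFrom d v O)
  parkFrom-refines d []      O c≤d = Pointwise.refl kept
  parkFrom-refines d (x ∷ v) O c≤d =
    Pointwise.transitive FillsLater-trans (place-refines x O c≤d) (parkFrom-refines (suc d) v (place d x O) (≤-trans c≤d (n≤1+n d)))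

  ⊆-Refines : ∀ {c} {s O₁ O₂ : Spots} → s ⊆ O₁ → Refines c O₁ O₂ → Σ[ s′ ∈ Spots ] (Refines c s s′ × s′ ⊆ O₂)
  ⊆-Refines []         []                         = [] , [] , []
  ⊆-Refines (_ ∷ʳ sub) (_∷_ {y = o′} _ refines)   with ⊆-Refines sub refines
  ... | s′ , s-refines , s′⊆ = s′ , s-refines , o′ ∷ʳ s′⊆
  ⊆-Refines (refl ∷ sub) (_∷_ {y = o′} r refines) with ⊆-Refines sub refines
  ... | s′ , s-refines , s′⊆ = o′ ∷ s′ , r ∷ s-refines , refl ∷ s′⊆

  CarsBelow : ℕ → Spots → Set
  CarsBelow c = All (Maybe.All (_< c))

  CarsBelow-mono : ∀ {c c′} {O : Spots} → c ≤ c′ → CarsBelow c O → CarsBelow c′ O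
  CarsBelow-mono c≤c′ = Data.List.Relation.Unary.All.map (Maybe.map (λ t<c → ≤-trans t<c c≤c′))

  place-CarsBelow : ∀ c x O → CarsBelow c O → CarsBelow (suc c) (place c x O)
  place-CarsBelow c x             []            _             = []
  place-CarsBelow c zero          (nothing ∷ O) (_ ∷ below)   = Maybe.just ≤-refl ∷ CarsBelow-mono (n≤1+n c) below
  place-CarsBelow c (suc zero)    (nothing ∷ O) (_ ∷ below)   = Maybe.just ≤-refl ∷ CarsBelow-mono (n≤1+n c) below
  place-CarsBelow c (suc (suc x)) (nothing ∷ O) (_ ∷ below)   = Maybe.nothing ∷ place-CarsBelow c (suc x) O below
  place-CarsBelow c x             (just a ∷ O)  (Maybe.just a<c ∷ below) =
    subst (CarsBelow (suc c)) (sym (place-just c x a O)) (Maybe.just (m≤n⇒m≤1+n a<c) ∷ place-CarsBelow c (pred x) O below)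

  CarsBelow-∈ : ∀ {c t} {O : Spots} → CarsBelow c O → just t ∈ O → t < c
  CarsBelow-∈ (Maybe.just t<c ∷ _) (here refl) = t<c
  CarsBelow-∈ (_ ∷ below)          (there t∈)  = CarsBelow-∈ below t∈

  ⊆-++-∷⁻ : ∀ {s : Spots} X z Y → s ⊆ X ++ z ∷ Y →
            (s ⊆ X ++ Y) ⊎ (Σ[ s₁ ∈ Spots ] Σ[ s₂ ∈ Spots ] (s ≡ s₁ ++ z ∷ s₂ × s₁ ⊆ X × s₂ ⊆ Y))
  ⊆-++-∷⁻ []      z Y (_ ∷ʳ sub)   = inj₁ sub
  ⊆-++-∷⁻ []      z Y (refl ∷ sub) = inj₂ ([] , _ , refl , [] , sub)
  ⊆-++-∷⁻ (x ∷ X) z Y (_ ∷ʳ sub) with ⊆-++-∷⁻ X z Y sub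
  ... | inj₁ sub′                         = inj₁ (x ∷ʳ sub′)
  ... | inj₂ (s₁ , s₂ , s≡ , s₁⊆ , s₂⊆) = inj₂ (s₁ , s₂ , s≡ , x ∷ʳ s₁⊆ , s₂⊆)
  ⊆-++-∷⁻ (x ∷ X) z Y (refl ∷ sub) with ⊆-++-∷⁻ X z Y sub
  ... | inj₁ sub′                         = inj₁ (refl ∷ sub′)
  ... | inj₂ (s₁ , s₂ , s≡ , s₁⊆ , s₂⊆) = inj₂ (x ∷ s₁ , s₂ , cong (x ∷_) s≡ , refl ∷ s₁⊆ , s₂⊆)

  ⊆-++-insert : ∀ {s : Spots} X z Y → s ⊆ X ++ Y → s ⊆ X ++ z ∷ Y
  ⊆-++-insert []      z Y sub          = z ∷ʳ sub
  ⊆-++-insert (x ∷ X) z Y (_ ∷ʳ sub)   = x ∷ʳ ⊆-++-insert X z Y sub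
  ⊆-++-insert (x ∷ X) z Y (refl ∷ sub) = refl ∷ ⊆-++-insert X z Y sub

  No312 : Spots → Set
  No312 O = ∀ a b c → just a ∷ just b ∷ just c ∷ [] ⊆ O → b < c → c < a → ⊥

  NoGapAscent : Spots → Set
  NoGapAscent O = ∀ b c → nothing ∷ just b ∷ just c ∷ [] ⊆ O → b < c → ⊥

  module _ (c : ℕ) (X Y : Spots) (X-ok : FilledThenEmpty X) (below : CarsBelow c (X ++ nothing ∷ Y))
           (no312 : No312 (X ++ nothing ∷ Y)) (no-ascent : NoGapAscent (X ++ nothing ∷ Y)) where

    private
      X-below : CarsBelow c X
      X-below = ++⁻ˡ X below
      Y-below : CarsBelow c Y
      Y-below = ++⁻ʳ (nothing ∷ []) (++⁻ʳ X below)

    No312-fill : No312 (X ++ just c ∷ Y)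
    No312-fill a b c′ sub b<c′ c′<a with ⊆-++-∷⁻ X (just c) Y sub
    ... | inj₁ sub′ = no312 a b c′ (⊆-++-insert X nothing Y sub′) b<c′ c′<a
    ... | inj₂ (s₁ , s₂ , s≡ , s₁⊆ , s₂⊆) = new s₁ s₂ s≡ s₁⊆ s₂⊆
      where
      new : ∀ s₁ s₂ → just a ∷ just b ∷ just c′ ∷ [] ≡ s₁ ++ just c ∷ s₂ → s₁ ⊆ X → s₂ ⊆ Y → ⊥
      new []                  s₂          refl s₁⊆ s₂⊆ = no-ascent b c′ (++⁺ s₁⊆ (refl ∷ s₂⊆)) b<c′
      new (_ ∷ [])            (_ ∷ [])    refl s₁⊆ s₂⊆ with All-resp-⊆ s₂⊆ Y-below
      ... | Maybe.just c′<c ∷ [] = <-asym b<c′ c′<c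
      new (_ ∷ _ ∷ [])        []          refl s₁⊆ s₂⊆ with All-resp-⊆ s₁⊆ X-below
      ... | Maybe.just a<c ∷ _ = <-asym c′<a a<c
      new (_ ∷ _ ∷ _ ∷ [])    _           () _ _
      new (_ ∷ _ ∷ _ ∷ _ ∷ _) _           () _ _

    NoGapAscent-fill : NoGapAscent (X ++ just c ∷ Y)
    NoGapAscent-fill b c′ sub b<c′ with ⊆-++-∷⁻ X (just c) Y sub
    ... | inj₁ sub′ = no-ascent b c′ (⊆-++-insert X nothing Y sub′) b<c′
    ... | inj₂ (s₁ , s₂ , s≡ , s₁⊆ , s₂⊆) = new s₁ s₂ s≡ s₁⊆ s₂⊆
      where
      new : ∀ s₁ s₂ → nothing ∷ just b ∷ just c′ ∷ [] ≡ s₁ ++ just c ∷ s₂ → s₁ ⊆ X → s₂ ⊆ Y → ⊥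
      new []                  _           () _ _
      new (_ ∷ [])            (_ ∷ [])    refl s₁⊆ s₂⊆ with All-resp-⊆ s₂⊆ Y-below
      ... | Maybe.just c′<c ∷ [] = <-asym b<c′ c′<c
      new (_ ∷ _ ∷ [])        []          refl s₁⊆ s₂⊆ = FilledThenEmpty-no-gap X-ok s₁⊆
      new (_ ∷ _ ∷ _ ∷ [])    _           () _ _
      new (_ ∷ _ ∷ _ ∷ _ ∷ _) _           () _ _

module Avoiding312 where

  open import Data.Nat using (ℕ; zero; suc; _≤_; _<_; z≤n; s≤s)
  open import Data.Nat.Properties using (<-irrefl; <-asym; <-trans; suc-injective; ≤-refl)
  open import Data.Bool using (true; false)
  open import Data.Maybe using (Maybe; just; nothing; is-just; fromMaybe)
  import Data.Maybe.Relation.Unary.All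
  open import Data.Fin using (Fin; zero; suc)
  open import Data.List using (List; []; _∷_; _++_; map; length; replicate; lookup)
  open import Data.List.Relation.Unary.All as All using (All; []; _∷_)
  open import Data.List.Relation.Unary.All.Properties using (map⁻)
  open import Data.List.Relation.Unary.Any using (here)
  open import Data.List.Membership.Propositional using (_∈_; find)
  open import Data.List.Membership.Propositional.Properties using (∈-map⁻; ∈-concatMap⁻)
  open import Data.List.Relation.Binary.Sublist.Propositional using (_⊆_; []; _∷_; _∷ʳ_)
  open import Data.List.Relation.Binary.Sublist.Propositional.Properties using (map⁺; All-resp-⊆)
  open import Data.List.Relation.Binary.Pointwise using ([]; _∷_)
  open import Data.Product using (Σ-syntax; _×_; _,_; proj₁; proj₂)
  open import Data.Sum using (inj₁; inj₂)
  open import Data.Empty using (⊥; ⊥-elim)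
  open import Function using (_⇔_; mk⇔; Equivalence; _∘_)
  open import Relation.Nullary using (¬_)
  open import Relation.Binary.PropositionalEquality
  open import Defs
  open Sums
  open ParkingLots
  open LastReturn using (catalanSum)
  open FirstGapCount using (goodCount-emptyLot)
  open Placement

  312-isomorphic : ∀ {t c e} → t < c → c < e → OrderIsomorphic (e ∷ t ∷ c ∷ []) pattern312
  312-isomorphic {t} {c} {e} t<c c<e = refl , compare
    where
    neither : ∀ {A B : Set} → ¬ A → ¬ B → A ⇔ B
    neither ¬a ¬b = mk⇔ (⊥-elim ∘ ¬a) (⊥-elim ∘ ¬b)
    both : ∀ {A B : Set} → A → B → A ⇔ B
    both a b = mk⇔ (λ _ → b) (λ _ → a)
    s : List ℕ
    s = e ∷ t ∷ c ∷ []
    compare : ∀ a b → (lookup s a < lookup s b) ⇔ (lookup pattern312 (Data.Fin.cast refl a) < lookup pattern312 (Data.Fin.cast refl b))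
    compare zero             zero             = neither (<-irrefl refl) (<-irrefl refl)
    compare zero             (suc zero)       = neither (λ e<t → <-asym e<t (<-trans t<c c<e)) (λ { (s≤s ()) })
    compare zero             (suc (suc zero)) = neither (λ e<c → <-asym e<c c<e) (λ { (s≤s (s≤s ())) })
    compare (suc zero)       zero             = both (<-trans t<c c<e) (s≤s (s≤s z≤n))
    compare (suc zero)       (suc zero)       = neither (<-irrefl refl) (<-irrefl refl)
    compare (suc zero)       (suc (suc zero)) = both t<c (s≤s (s≤s z≤n))
    compare (suc (suc zero)) zero             = both c<e (s≤s (s≤s (s≤s z≤n)))
    compare (suc (suc zero)) (suc zero)       = neither (λ c<t → <-asym c<t t<c) (λ { (s≤s ()) })
    compare (suc (suc zero)) (suc (suc zero)) = neither (<-irrefl refl) (<-irrefl refl)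

  Contains312⇒ : ∀ π → Contains π pattern312 → Σ[ a ∈ ℕ ] Σ[ b ∈ ℕ ] Σ[ c ∈ ℕ ] (a ∷ b ∷ c ∷ [] ⊆ π × b < c × c < a)
  Contains312⇒ π (a ∷ b ∷ c ∷ [] , sub , _ , iso) =
    a , b , c , sub , Equivalence.from (iso (suc zero) (suc (suc zero))) (s≤s (s≤s z≤n))
                    , Equivalence.from (iso (suc (suc zero)) zero) (s≤s (s≤s (s≤s z≤n)))
  Contains312⇒ π ([]                    , _ , () , _)
  Contains312⇒ π (_ ∷ []                , _ , () , _)
  Contains312⇒ π (_ ∷ _ ∷ []            , _ , () , _)
  Contains312⇒ π (_ ∷ _ ∷ _ ∷ _ ∷ _     , _ , () , _)

  AllParked : Spots → Set
  AllParked = All ((_≡ true) ∘ is-just)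

  ⊆-map-fromMaybe : ∀ {s : List ℕ} {F : Spots} → s ⊆ map (fromMaybe 0) F → AllParked F → map just s ⊆ F
  ⊆-map-fromMaybe {F = []}           []           _             = []
  ⊆-map-fromMaybe {F = o ∷ F}        (_ ∷ʳ sub)   (_ ∷ parked)  = o ∷ʳ ⊆-map-fromMaybe sub parked
  ⊆-map-fromMaybe {F = just t ∷ F}   (refl ∷ sub) (_ ∷ parked)  = refl ∷ ⊆-map-fromMaybe sub parked
  ⊆-map-fromMaybe {F = nothing ∷ F}  (refl ∷ sub) (() ∷ _)

  No312⇒Avoids : ∀ F → AllParked F → No312 F → Avoids (map (fromMaybe 0) F) pattern312
  No312⇒Avoids F parked no312 contains with Contains312⇒ _ contains
  ... | a , b , c , sub , b<c , c<a = no312 a b c (⊆-map-fromMaybe sub parked) b<c c<a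

  emptySpots : ℕ → Spots
  emptySpots n = replicate n nothing

  private
    no-car : ∀ n {a : ℕ} {rest : Spots} → ¬ (just a ∷ rest ⊆ emptySpots n)
    no-car (suc n) (_ ∷ʳ sub) = no-car n sub
    no-car (suc n) (() ∷ _)

  No312-emptySpots : ∀ n → No312 (emptySpots n)
  No312-emptySpots n a b c sub = ⊥-elim (no-car n sub)

  NoGapAscent-emptySpots : ∀ n → NoGapAscent (emptySpots n)
  NoGapAscent-emptySpots (suc n) b c (_ ∷ʳ sub)   = NoGapAscent-emptySpots n b c sub
  NoGapAscent-emptySpots (suc n) b c (refl ∷ sub) = ⊥-elim (no-car n sub)

  CarsBelow-emptySpots : ∀ c n → CarsBelow c (emptySpots n)
  CarsBelow-emptySpots c zero    = []
  CarsBelow-emptySpots c (suc n) = Data.Maybe.Relation.Unary.All.nothing ∷ CarsBelow-emptySpots c n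

  occupancy-emptySpots : ∀ n → occupancy (emptySpots n) ≡ emptyLot n
  occupancy-emptySpots zero    = refl
  occupancy-emptySpots (suc n) = cong (false ∷_) (occupancy-emptySpots n)

  private
    free-after-place : ∀ c x O {k} → 1 ≤ freeFrom x (occupancy O) → suc k ≡ freeFrom 0 (occupancy O) →
                       k ≡ freeFrom 0 (occupancy (place c x O))
    free-after-place c x O free #free = trans (suc-injective (trans #free (sym (freeFrom-occupy-≤ (occupancy O) x 0 free z≤n))))
                                              (cong (freeFrom 0) (sym (occupancy-place c x O)))

  allInFirstGap⇒No312 : ∀ v O c → allInFirstGap (occupancy O) v ≡ true → length v ≡ freeFrom 0 (occupancy O) →
    No312 O → NoGapAscent O → CarsBelow c O → AllParked (parkFrom c v O) × No312 (parkFrom c v O)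
  allInFirstGap⇒No312 []      O c _   #v no312 _ _ = map⁻ (freeFrom0≡0⇒Full (occupancy O) (sym #v)) , no312
  allInFirstGap⇒No312 (x ∷ v) O c all #v no312 no-ascent below
    with ∧≡true⁻ {inFirstGap x (occupancy O)} all
  ... | inGap , rest with inFirstGap⇒ParksInFirstGap c x O inGap
  ... | X , Y , O≡ , placed , X-ok =
    allInFirstGap⇒No312 v (place c x O) (suc c)
      (subst (λ B → allInFirstGap B v ≡ true) (sym (occupancy-place c x O)) rest)
      (free-after-place c x O (inFirstGap⇒free x (occupancy O) inGap) #v)
      (subst No312 (sym placed) (No312-fill c X Y X-ok below′ no312′ no-ascent′))
      (subst NoGapAscent (sym placed) (NoGapAscent-fill c X Y X-ok below′ no312′ no-ascent′))
      (place-CarsBelow c x O below)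
    where
    below′ : CarsBelow c (X ++ nothing ∷ Y)
    below′ = subst (CarsBelow c) O≡ below
    no312′ : No312 (X ++ nothing ∷ Y)
    no312′ = subst No312 O≡ no312
    no-ascent′ : NoGapAscent (X ++ nothing ∷ Y)
    no-ascent′ = subst NoGapAscent O≡ no-ascent

  Avoids⇒allInFirstGap : ∀ v O c → Hall (occupancy O) v → length v ≡ freeFrom 0 (occupancy O) → CarsBelow c O →
    Avoids (map (fromMaybe 0) (parkFrom c v O)) pattern312 → allInFirstGap (occupancy O) v ≡ true
  Avoids⇒allInFirstGap []      O c _    _  _     _      = refl
  Avoids⇒allInFirstGap (x ∷ v) O c hall #v below avoids with Hall-∷⁻ (occupancy O) x v hall
  ... | free , hall′ with inFirstGap x (occupancy O) in inGap
  ... | true  = ∧≡true⁺ refl (subst (λ B → allInFirstGap B v ≡ true) (occupancy-place c x O)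
                  (Avoids⇒allInFirstGap v (place c x O) (suc c)
                     (subst (λ B → Hall B v) (sym (occupancy-place c x O)) hall′)
                     (free-after-place c x O free #v) (place-CarsBelow c x O below) avoids))
  ... | false = ⊥-elim contradiction
    where
    final : Spots
    final = parkFrom (suc c) v (place c x O)
    parked : AllParked final
    parked = map⁻ (subst Full (sym (trans (occupancy-parkFrom (suc c) v (place c x O)) (cong (occupyAll v) (occupancy-place c x O))))
                         (Hall⇒occupyAll-Full (occupy x (occupancy O)) v hall′
                            (suc-injective (trans #v (sym (freeFrom-occupy-≤ (occupancy O) x 0 free z≤n))))))
    contradiction : ⊥
    contradiction with ¬inFirstGap⇒gap-before c x O inGap free
    ... | t , t∈ , sub with ⊆-Refines sub (parkFrom-refines {suc c} (suc c) v (place c x O) ≤-refl)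
    ... | (.nothing ∷ _) , (kept ∷ _) , sub′ with All-resp-⊆ sub′ parked
    ...   | () ∷ _
    contradiction | t , t∈ , sub | (just e ∷ .(just t) ∷ .(just c) ∷ []) , (filled c<e ∷ kept ∷ kept ∷ []) , sub′ =
      avoids (e ∷ t ∷ c ∷ [] , map⁺ (fromMaybe 0) sub′ , 312-isomorphic (CarsBelow-∈ below t∈) c<e)

  ∈-words⁻ : ∀ k N {f} → f ∈ words k N → length f ≡ k × All (λ x → 1 ≤ x × x ≤ N) f
  ∈-words⁻ zero    N (here refl) = refl , []
  ∈-words⁻ (suc k) N f∈ with find (∈-concatMap⁻ (λ v → map (_∷ v) (fromTo 1 N)) {xs = words k N} f∈)
  ... | v , v∈ , f∈′ with ∈-map⁻ (_∷ v) f∈′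
  ... | x , x∈ , refl with ∈-words⁻ k N v∈
  ... | #v , v-bounded = cong suc #v , ∈-fromTo⁻ 1 N x∈ ∷ v-bounded

  PF312⇔allInFirstGap : ∀ n {f} → f ∈ allFuns n → PF312 n f ⇔ (allInFirstGap (emptyLot n) f ≡ true)
  PF312⇔allInFirstGap n {f} f∈ = mk⇔ to from
    where
    #f : length f ≡ n
    #f = proj₁ (∈-words⁻ n n f∈)
    f≤n : All (_≤ n) f
    f≤n = All.map proj₂ (proj₂ (∈-words⁻ n n f∈))
    lot≡ : occupancy (emptySpots n) ≡ emptyLot n
    lot≡ = occupancy-emptySpots n
    #f′ : length f ≡ freeFrom 0 (occupancy (emptySpots n))
    #f′ = trans #f (sym (trans (cong (freeFrom 0) lot≡) (freeFrom-emptyLot-0 n)))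
    parkingPerm≡ : parkingPerm f ≡ map (fromMaybe 0) (parkFrom 1 f (emptySpots n))
    parkingPerm≡ = cong (λ k → map (fromMaybe 0) (parkFrom 1 f (emptySpots k))) #f
    to : PF312 n f → allInFirstGap (emptyLot n) f ≡ true
    to (pf , avoids) = subst (λ B → allInFirstGap B f ≡ true) lot≡
      (Avoids⇒allInFirstGap f (emptySpots n) 1 (subst (λ B → Hall B f) (sym lot≡) (IsParkingFunction⇒Hall n f #f f≤n pf))
         #f′ (CarsBelow-emptySpots 1 n) (subst (λ π → Avoids π pattern312) parkingPerm≡ avoids))
    from : allInFirstGap (emptyLot n) f ≡ true → PF312 n f
    from all with allInFirstGap⇒No312 f (emptySpots n) 1 (subst (λ B → allInFirstGap B f ≡ true) (sym lot≡) all) #f′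
                    (No312-emptySpots n) (NoGapAscent-emptySpots n) (CarsBelow-emptySpots 1 n)
    ... | parked , no312 = Hall⇒IsParkingFunction n f #f (allInFirstGap⇒Hall (emptyLot n) f all)
                         , subst (λ π → Avoids π pattern312) (sym parkingPerm≡) (No312⇒Avoids _ parked no312)

  CountOver-PF312 : ∀ n → CountOver (PF312 n) (allFuns n) (catalanSum n 0)
  CountOver-PF312 n = subst (CountOver (PF312 n) (allFuns n)) (goodCount-emptyLot n)
    (SumOver-∑ (λ f → 𝟙 (allInFirstGap (emptyLot n) f)) (allFuns n) classify)
    where
    classify : ∀ {f} → f ∈ allFuns n → Restricts (PF312 n) (λ _ → 1) (λ f → 𝟙 (allInFirstGap (emptyLot n) f)) f
    classify {f} f∈ with allInFirstGap (emptyLot n) f in good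
    ... | true  = inj₁ (Equivalence.from (PF312⇔allInFirstGap n f∈) good , refl)
    ... | false = inj₂ ((λ pf312 → true≢false (trans (sym (Equivalence.to (PF312⇔allInFirstGap n f∈) pf312)) good)) , refl)

open LastReturn using (catalanSum; SumOver-catalanSum)
open FirstRuns using (catalanSum-PRec)
open GeneratingFunction using (gfCoeff-catalanSum)
open Avoiding312 using (CountOver-PF312)

mainTheorem4 : Σ[ pk ∈ (ℕ → ℕ) ]
    ((∀ n → 1 ≤ n → CountOver (PF312 n) (allFuns n) (pk n))
    × (∀ n → 1 ≤ n → SumOver (IsCatalan n) catWeight (allSteps (2 Data.Nat.* n)) (pk n))
    × (∀ (p : ℕ → ℕ → ℕ) → PRec p → ∀ n → 1 ≤ n → pk n ≡ sum (map (p n) (fromTo 1 n)))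
    × (∀ N → gfCoeff pk N ≡ xOverOneMinusX N))
mainTheorem4 = (λ n → catalanSum n 0)
             , (λ n _ → CountOver-PF312 n)
             , (λ n _ → SumOver-catalanSum n)
             , catalanSum-PRec
             , gfCoeff-catalanSum
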